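{- For every integer $n\ge 5$, the graph $U_n$ is uniformly most reliable with respect to node cop-win reliability among all unicyclic graphs of order $n$; that is, $\operatorname{NCRel}(G,p)\le \operatorname{NCRel}(U_n,p)$ for every $p\in[0,1]$ and every unicyclic graph $G$ of order $n$.
   Context: All graphs are finite, simple and undirected. A unicyclic graph is a connected graph $G$ with $|V(G)|=|E(G)|$. The graph $U_n$ is $(K_2\cup\overline{K_{n-3}})\vee K_1$, i.e. a vertex $c$ adjacent to all other $n-1$ vertices, where among the other vertices there is exactly one edge $ab$ (so $U_n$ is a triangle $cab$ with $n-3$ pendant leaves attached at $c$). A graph is cop-win if, in the game of Cops and Robber with one cop (the cop chooses a starting vertex, then the robber chooses one, then they alternately move to an adjacent vertex or stay put, the cop winning if he ever occupies the robber's vertex), the cop can guarantee capture. For a graph $G$ of order $n$, let $W_i(G)$ be the number of vertex subsets of size $i$ inducing a cop-win subgraph of $G$; the node cop-win reliability is $\operatorname{NCRel}(G,p)=\sum_{i=1}^n W_i(G)(1-p)^{n-i}p^i$, the probability that the set of operational vertices induces a cop-win graph when each vertex is operational independently with probability $p$.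
   Formalization: The parameter $p$ ranges over the rationals in $[0,1]$. -}

module Defs where

open import Data.Bool using (Bool; true; false; if_then_else_; _∧_)
open import Data.Nat using (ℕ; zero; suc; _<ᵇ_; _∸_; _≤_)
open import Data.Fin using (Fin; toℕ)
open import Data.Fin.Subset using (Subset; ∣_∣) renaming (_∈_ to _∈ₛ_)
open import Data.List using (List; length; map; allFin)
open import Data.Nat.ListAction using (sum)
open import Data.List.Membership.Propositional using (_∈_)
open import Data.List.Relation.Unary.Unique.Propositional using (Unique)
open import Data.Integer using (+_)
open import Data.Rational using (ℚ; 1ℚ; _/_; _*_; _+_; _-_)
open import Data.Product using (Σ; ∃; _×_)
open import Data.Sum using (_⊎_)
open import Relation.Binary.PropositionalEquality using (_≡_; refl)

record Graph (n : ℕ) : Set where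
  field
    adj    : Fin n → Fin n → Bool
    sym    : ∀ i j → adj i j ≡ adj j i
    irrefl : ∀ i → adj i i ≡ false
open Graph public

Adj : ∀ {n} → Graph n → Fin n → Fin n → Set
Adj G i j = adj G i j ≡ true

Close : ∀ {n} → Graph n → Fin n → Fin n → Set
Close G i j = (i ≡ j) ⊎ Adj G i j

data Reach {n : ℕ} (G : Graph n) : Fin n → Fin n → Set where
  here : ∀ {u} → Reach G u u
  step : ∀ {u v w} → Adj G u v → Reach G v w → Reach G u w

Connected : ∀ {n} → Graph n → Set
Connected G = ∀ u v → Reach G u v

edgeCount : ∀ {n} → Graph n → ℕ
edgeCount {n} G =
  sum (map (λ i → sum (map (λ j → if adj G i j ∧ (toℕ i <ᵇ toℕ j) then 1 else 0)
                              (allFin n)))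
           (allFin n))

Unicyclic : ∀ {n} → Graph n → Set
Unicyclic {n} G = Connected G × edgeCount G ≡ n

-- The graph U_n: vertex 0 = c (adjacent to all others), vertices 1,2 = a,b
-- with the single extra edge ab; vertices 3..n-1 are pendant leaves at c.

private
  g : ℕ → ℕ → Bool      -- adjacency among the non-centre vertices (shifted by 1)
  g 0 0 = false
  g 0 1 = true
  g 0 (suc (suc _)) = false
  g 1 0 = true
  g 1 (suc _) = false
  g (suc (suc _)) _ = false

  uAdjℕ : ℕ → ℕ → Bool
  uAdjℕ 0 0 = false
  uAdjℕ 0 (suc _) = true
  uAdjℕ (suc _) 0 = true
  uAdjℕ (suc i) (suc j) = g i j

  g-sym : ∀ i j → g i j ≡ g j i
  g-sym 0 0 = refl
  g-sym 0 1 = refl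
  g-sym 0 (suc (suc _)) = refl
  g-sym 1 0 = refl
  g-sym 1 (suc zero) = refl
  g-sym 1 (suc (suc _)) = refl
  g-sym (suc (suc _)) 0 = refl
  g-sym (suc (suc _)) (suc zero) = refl
  g-sym (suc (suc _)) (suc (suc _)) = refl

  g-irr : ∀ i → g i i ≡ false
  g-irr 0 = refl
  g-irr 1 = refl
  g-irr (suc (suc _)) = refl

  uAdjℕ-sym : ∀ i j → uAdjℕ i j ≡ uAdjℕ j i
  uAdjℕ-sym 0 0 = refl
  uAdjℕ-sym 0 (suc _) = refl
  uAdjℕ-sym (suc _) 0 = refl
  uAdjℕ-sym (suc i) (suc j) = g-sym i j

  uAdjℕ-irr : ∀ i → uAdjℕ i i ≡ false
  uAdjℕ-irr 0 = refl
  uAdjℕ-irr (suc i) = g-irr i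

U : (n : ℕ) → Graph n
U n = record
  { adj    = λ i j → uAdjℕ (toℕ i) (toℕ j)
  ; sym    = λ i j → uAdjℕ-sym (toℕ i) (toℕ j)
  ; irrefl = λ i → uAdjℕ-irr (toℕ i)
  }

-- Cops and Robber (one cop) on the subgraph of G induced by S.
-- CopWinsFrom G S c r : cop at c, robber at r, cop to move, and the cop
-- can force capture in finitely many moves (inductive = least fixed point).

data CopWinsFrom {n : ℕ} (G : Graph n) (S : Subset n) (c r : Fin n) : Set where
  move : (c' : Fin n) → c' ∈ₛ S → Close G c c' →
         ((c' ≡ r) ⊎
          (∀ r' → r' ∈ₛ S → Close G r r' → (r' ≡ c') ⊎ CopWinsFrom G S c' r')) →
         CopWinsFrom G S c r

CopWin : ∀ {n} → Graph n → Subset n → Set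
CopWin G S = Σ _ λ c → c ∈ₛ S × (∀ r → r ∈ₛ S → (c ≡ r) ⊎ CopWinsFrom G S c r)

-- IsW G i k : k = W_i(G), the number of i-subsets of V(G) inducing a
-- cop-win subgraph (witnessed by a duplicate-free list listing exactly them).
IsW : ∀ {n} → Graph n → ℕ → ℕ → Set
IsW {n} G i k =
  Σ (List (Subset n)) λ L →
    Unique L × length L ≡ k ×
    (∀ S → (S ∈ L → ∣ S ∣ ≡ i × CopWin G S) × (∣ S ∣ ≡ i × CopWin G S → S ∈ L))

ℕtoℚ : ℕ → ℚ
ℕtoℚ k = (+ k) / 1

_^ℚ_ : ℚ → ℕ → ℚ
x ^ℚ zero = 1ℚ
x ^ℚ suc k = x * (x ^ℚ k)

sumFrom1 : ℕ → (ℕ → ℚ) → ℚ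
sumFrom1 zero f = (+ 0) / 1
sumFrom1 (suc m) f = sumFrom1 m f + f (suc m)

NCRelPoly : (n : ℕ) → (ℕ → ℕ) → ℚ → ℚ
NCRelPoly n W p = sumFrom1 n λ i → ℕtoℚ (W i) * (((1ℚ - p) ^ℚ (n ∸ i)) * (p ^ℚ i))

-- With x_i = (1 - p)^(n - i) p^i ≥ 0 we have NCRel(G, p) = ∑ W_i(G) x_i, and W_i(U_n) is at least
-- W[U] n i, counting the i-sets through the centre, the singletons and the edge ab.
-- If the unicyclic graph G has a leaf l with neighbour u, the cop-win i-sets avoiding l are cop-win
-- in G - l, while those through l (for i ≥ 2) contain u and are determined by an (i - 2)-subset of
-- G - l - u; by induction on the order and Pascal's rule W_i(G) ≤ W[U] n i, so the claim holds
-- term by term. When G - l is a cycle, retracting l onto u and counting arcs keeps the induction going.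
-- Otherwise G is the cycle C_n: a cop-win set is connected, and C_n itself is not cop-win, so the
-- cop-win i-sets are among the n arcs of each length i < n. These beat U_n only at i = n - 1, by one,
-- and x_(n-1) ≤ x_(n-2) + x_n absorbs the difference since U_n has spare sets at i = n - 2 and i = n.

module Submission where

open import Algebra.Properties.CommutativeSemigroup using (interchange)
open import Data.Bool using (Bool; true; false; _∧_; if_then_else_; T)
open import Data.Bool.Properties using (∧-conicalˡ; ∧-conicalʳ; ∧-zeroʳ; ∧-identityʳ; ¬-not) renaming (_≟_ to _≟ᵇ_)
open import Data.Empty using (⊥; ⊥-elim)
open import Data.Fin using (Fin; zero; suc; toℕ; fromℕ<)
open import Data.Fin.Properties using (any?; toℕ<n; toℕ-fromℕ<; toℕ-injective) renaming (_≟_ to _≟ᶠ_; suc-injective to fsuc-injective)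
open import Data.Fin.Subset using (Subset; ∣_∣; ⊤) renaming (_∈_ to _∈ₛ_; ⊥ to ∅)
open import Data.Fin.Subset.Properties using (∣⊥∣≡0; ∣⊤∣≡n)
import Data.Integer as ℤ
import Data.Integer.Properties as ℤ
open import Data.List using (List; []; _∷_; map; _++_; length; filter; upTo; tabulate; allFin)
open import Data.List.Membership.Propositional using (_∈_)
open import Data.List.Membership.Propositional.Properties using (∈-map⁺; ∈-map⁻; ∈-++⁺ˡ; ∈-++⁺ʳ; ∈-++⁻; ∈-upTo⁺; ∈-filter⁻)
open import Data.List.Properties using (length-map; length-++; length-upTo; map-tabulate; map-cong)
open import Data.List.Relation.Binary.Subset.Propositional using (_⊆_)
open import Data.List.Relation.Unary.All using (All; []; _∷_)
open import Data.List.Relation.Unary.AllPairs using ([]; _∷_)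
open import Data.List.Relation.Unary.Any using (here; there)
open import Data.List.Relation.Unary.Unique.Propositional using (Unique)
open import Data.List.Relation.Unary.Unique.Propositional.Properties using (++⁺; map⁺; filter⁺)
open import Data.Nat
open import Data.Nat.Combinatorics using (_C_; nCk+nC[k+1]≡[n+1]C[k+1]; nC1≡n)
open import Data.Nat.Coprimality using (1-coprimeTo) renaming (sym to coprime-sym)
open import Data.Nat.ListAction using () renaming (sum to sumˡ)
open import Data.Nat.Properties
open import Data.Product using (∃; ∃₂; _×_; _,_; proj₁; proj₂; map₁)
open import Data.Rational using (ℚ; mkℚ; 0ℚ; 1ℚ; *≤*; toℚᵘ; nonNegative; nonPositive)
  renaming (_≤_ to _≤ℚ_; _+_ to _+ℚ_; _*_ to _*ℚ_; _-_ to _-ℚ_; -_ to -ℚ_)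
import Data.Rational.Properties as ℚ
open import Data.Rational.Solver using (module +-*-Solver)
import Data.Rational.Unnormalised as ℚᵘ
import Data.Rational.Unnormalised.Properties as ℚᵘ
open import Data.Sum using (_⊎_; inj₁; inj₂)
open import Data.Vec using (Vec; _∷_; lookup; _[_]≔_)
open import Data.Vec.Properties
  using (tabulate∘lookup; tabulate-cong; lookup∘update; lookup∘update′; ∷-injectiveʳ; []=⇒lookup; lookup⇒[]=; lookup-replicate)
open import Function using (_∘_; id)
open import Relation.Binary.Definitions using (tri<; tri≈; tri>)
open import Relation.Binary.PropositionalEquality
open import Relation.Nullary using (Dec; yes; no; does; ¬_; ¬?; _×-dec_; _⊎-dec_; contradiction)
open import Relation.Unary using (Pred; Decidable)

open import Defs hiding (sym)
open import Algebra.Properties.Monoid.Sum +-0-monoid using () renaming (sum to ∑; sum-cong-≗ to ∑-cong)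

bool→ℕ : Bool → ℕ
bool→ℕ b = if b then 1 else 0

bool→ℕ≥1⇒true : ∀ {b} → 1 ≤ bool→ℕ b → b ≡ true
bool→ℕ≥1⇒true {true} _ = refl

∑-+ : ∀ {n} (f g : Fin n → ℕ) → ∑ (λ x → f x + g x) ≡ ∑ f + ∑ g
∑-+ {zero} f g = refl
∑-+ {suc n} f g = trans (cong (f zero + g zero +_) (∑-+ (f ∘ suc) (g ∘ suc)))
                        (interchange +-commutativeSemigroup (f zero) (g zero) (∑ (f ∘ suc)) (∑ (g ∘ suc)))

∑-*ʳ : ∀ {n} (f : Fin n → ℕ) c → ∑ (λ x → f x * c) ≡ ∑ f * c
∑-*ʳ {zero} f c = refl
∑-*ʳ {suc n} f c = trans (cong (f zero * c +_) (∑-*ʳ (f ∘ suc) c)) (sym (*-distribʳ-+ c (f zero) _))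

∑-zero : ∀ {n} {f : Fin n → ℕ} → (∀ x → f x ≡ 0) → ∑ f ≡ 0
∑-zero {zero} h = refl
∑-zero {suc n} h = cong₂ _+_ (h zero) (∑-zero (h ∘ suc))

∑-mono-≤ : ∀ {n} {f g : Fin n → ℕ} → (∀ x → f x ≤ g x) → ∑ f ≤ ∑ g
∑-mono-≤ {zero} h = z≤n
∑-mono-≤ {suc n} h = +-mono-≤ (h zero) (∑-mono-≤ (h ∘ suc))

∑-mono-≤-tight : ∀ {n} {f g : Fin n → ℕ} → (∀ x → f x ≤ g x) → ∑ f ≡ ∑ g → ∀ x → f x ≡ g x
∑-mono-≤-tight {suc n} {f} {g} f≤g eq x with m≤n⇒m<n∨m≡n (f≤g zero)
... | inj₁ lt = ⊥-elim (<⇒≢ (+-mono-<-≤ lt (∑-mono-≤ (f≤g ∘ suc))) eq)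
... | inj₂ eq₀ with x
...   | zero = eq₀
...   | suc y = ∑-mono-≤-tight (f≤g ∘ suc) (+-cancelˡ-≡ (g zero) _ _ (trans (cong (_+ _) (sym eq₀)) eq)) y

∑-update : ∀ {n} (f g : Fin n → ℕ) x → (∀ y → y ≢ x → f y ≡ g y) → ∑ f + g x ≡ ∑ g + f x
∑-update {suc n} f g zero agree = begin
  f zero + ∑ (f ∘ suc) + g zero   ≡⟨ cong (λ t → f zero + t + g zero) (∑-cong (λ y → agree (suc y) λ ())) ⟩
  f zero + ∑ (g ∘ suc) + g zero   ≡⟨ +-assoc (f zero) _ _ ⟩
  f zero + (∑ (g ∘ suc) + g zero) ≡⟨ +-comm (f zero) _ ⟩
  ∑ (g ∘ suc) + g zero + f zero   ≡⟨ cong (_+ f zero) (+-comm (∑ (g ∘ suc)) (g zero)) ⟩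
  g zero + ∑ (g ∘ suc) + f zero   ∎
  where open ≡-Reasoning
∑-update {suc n} f g (suc x) agree = begin
  f zero + ∑ (f ∘ suc) + g (suc x)   ≡⟨ +-assoc (f zero) _ _ ⟩
  f zero + (∑ (f ∘ suc) + g (suc x)) ≡⟨ cong₂ _+_ (agree zero λ ()) (∑-update (f ∘ suc) (g ∘ suc) x λ y y≢x → agree (suc y) (y≢x ∘ fsuc-injective)) ⟩
  g zero + (∑ (g ∘ suc) + f (suc x)) ≡⟨ +-assoc (g zero) _ _ ⟨
  g zero + ∑ (g ∘ suc) + f (suc x)   ∎
  where open ≡-Reasoning

∑>0⇒∃>0 : ∀ {n} (f : Fin n → ℕ) → 1 ≤ ∑ f → ∃ λ x → 1 ≤ f x
∑>0⇒∃>0 {suc n} f h with f zero in eq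
... | suc _ = zero , subst (1 ≤_) (sym eq) (s≤s z≤n)
... | zero with ∑>0⇒∃>0 (f ∘ suc) h
...   | x , p = suc x , p

f≤∑f : ∀ {n} (f : Fin n → ℕ) x → f x ≤ ∑ f
f≤∑f {suc n} f zero = m≤m+n _ _
f≤∑f {suc n} f (suc x) = ≤-trans (f≤∑f (f ∘ suc) x) (m≤n+m _ _)

f+f≤∑f : ∀ {n} (f : Fin n → ℕ) x y → x ≢ y → f x + f y ≤ ∑ f
f+f≤∑f {suc n} f zero zero x≢y = ⊥-elim (x≢y refl)
f+f≤∑f {suc n} f zero (suc y) _ = +-monoʳ-≤ (f zero) (f≤∑f (f ∘ suc) y)
f+f≤∑f {suc n} f (suc x) zero _ = subst (_≤ ∑ f) (+-comm (f zero) (f (suc x))) (+-monoʳ-≤ (f zero) (f≤∑f (f ∘ suc) x))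
f+f≤∑f {suc n} f (suc x) (suc y) x≢y = ≤-trans (f+f≤∑f (f ∘ suc) x y (x≢y ∘ cong suc)) (m≤n+m _ _)

∑-comm : ∀ {n m} (h : Fin n → Fin m → ℕ) → ∑ (λ x → ∑ (h x)) ≡ ∑ (λ y → ∑ (λ x → h x y))
∑-comm {zero} {m} h = sym (∑-zero {m} {λ y → ∑ {0} (λ x → h x y)} λ _ → refl)
∑-comm {suc n} h = trans (cong (∑ (h zero) +_) (∑-comm (h ∘ suc))) (sym (∑-+ (h zero) (λ y → ∑ (λ x → h (suc x) y))))

δ : ∀ {n} → Fin n → Fin n → ℕ
δ x y = bool→ℕ (does (x ≟ᶠ y))

δ-refl : ∀ {n} (x : Fin n) → δ x x ≡ 1
δ-refl x with x ≟ᶠ x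
... | yes _ = refl
... | no x≢x = ⊥-elim (x≢x refl)

δ-≢ : ∀ {n} {x y : Fin n} → x ≢ y → δ x y ≡ 0
δ-≢ {x = x} {y} x≢y with x ≟ᶠ y
... | yes x≡y = ⊥-elim (x≢y x≡y)
... | no _ = refl

∑-δ : ∀ {n} (x : Fin n) → ∑ (δ x) ≡ 1
∑-δ {suc n} zero = cong suc (∑-zero {n} {δ zero ∘ suc} (λ y → δ-≢ {x = zero} {suc y} λ ()))
∑-δ {suc n} (suc x) = trans (cong (_+ ∑ (δ (suc x) ∘ suc)) (δ-≢ {x = suc x} {zero} λ ())) (∑-δ x)

_⊑_ : ∀ {n} → Subset n → Subset n → Set
S ⊑ T = ∀ x → lookup S x ≡ true → lookup T x ≡ true

∣S∣≡∑ : ∀ {n} (S : Subset n) → ∣ S ∣ ≡ ∑ (bool→ℕ ∘ lookup S)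
∣S∣≡∑ Vec.[] = refl
∣S∣≡∑ (true ∷ S) = cong suc (∣S∣≡∑ S)
∣S∣≡∑ (false ∷ S) = ∣S∣≡∑ S

subset-ext : ∀ {n} {S T : Subset n} → (∀ x → lookup S x ≡ lookup T x) → S ≡ T
subset-ext {S = S} {T} h = trans (sym (tabulate∘lookup S)) (trans (tabulate-cong h) (tabulate∘lookup T))

⊑-antisym : ∀ {n} {S T : Subset n} → S ⊑ T → T ⊑ S → S ≡ T
⊑-antisym {S = S} {T} S⊑T T⊑S = subset-ext pointwise
  where
  pointwise : ∀ x → lookup S x ≡ lookup T x
  pointwise x with lookup S x in eS | lookup T x in eT
  ... | true | true = refl
  ... | false | false = refl
  ... | true | false = trans (sym (S⊑T x eS)) eT
  ... | false | true = trans (sym eS) (T⊑S x eT)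

⊑⇒∣∣≤ : ∀ {n} {S T : Subset n} → S ⊑ T → ∣ S ∣ ≤ ∣ T ∣
⊑⇒∣∣≤ {S = S} {T} S⊑T = subst₂ _≤_ (sym (∣S∣≡∑ S)) (sym (∣S∣≡∑ T)) (∑-mono-≤ pointwise)
  where
  pointwise : ∀ x → bool→ℕ (lookup S x) ≤ bool→ℕ (lookup T x)
  pointwise x with lookup S x in eS
  ... | false = z≤n
  ... | true rewrite S⊑T x eS = s≤s z≤n

∈⇒1≤∣∣ : ∀ {n} (S : Subset n) {x} → lookup S x ≡ true → 1 ≤ ∣ S ∣
∈⇒1≤∣∣ S {x} x∈S = subst (1 ≤_) (sym (∣S∣≡∑ S)) (subst (_≤ ∑ (bool→ℕ ∘ lookup S)) (cong bool→ℕ x∈S) (f≤∑f (bool→ℕ ∘ lookup S) x))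

⊑⊎∃∈∖ : ∀ {n} (A S : Subset n) → A ⊑ S ⊎ ∃ λ z → lookup A z ≡ true × lookup S z ≡ false
⊑⊎∃∈∖ A S with any? (λ z → (lookup A z ≟ᵇ true) ×-dec (lookup S z ≟ᵇ false))
... | yes witness = inj₂ witness
... | no none = inj₁ A⊑S
  where
  A⊑S : A ⊑ S
  A⊑S x x∈A with lookup S x in e
  ... | true = refl
  ... | false = ⊥-elim (none (x , x∈A , e))

∣∣≤1⇒≡ : ∀ {n} (S : Subset n) {x y} → ∣ S ∣ ≤ 1 → lookup S x ≡ true → lookup S y ≡ true → x ≡ y
∣∣≤1⇒≡ S {x} {y} ∣S∣≤1 x∈S y∈S with x ≟ᶠ y
... | yes x≡y = x≡y
... | no x≢y = ⊥-elim (<⇒≱ (s≤s (s≤s z≤n)) (≤-trans two≤∑ (subst (_≤ 1) (∣S∣≡∑ S) ∣S∣≤1)))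
  where
  two≤∑ : 2 ≤ ∑ (bool→ℕ ∘ lookup S)
  two≤∑ = subst₂ (λ a b → bool→ℕ a + bool→ℕ b ≤ _) x∈S y∈S (f+f≤∑f (bool→ℕ ∘ lookup S) x y x≢y)

∃∈≢ : ∀ {n} (S : Subset n) x → 2 ≤ ∣ S ∣ → ∃ λ y → lookup S y ≡ true × y ≢ x
∃∈≢ S x two≤∣S∣ with any? (λ y → (lookup S y ≟ᵇ true) ×-dec ¬? (y ≟ᶠ x))
... | yes witness = witness
... | no none = ⊥-elim (<⇒≱ two≤∣S∣ (subst (_≤ 1) (sym (∣S∣≡∑ S)) (subst (∑ (bool→ℕ ∘ lookup S) ≤_) (∑-δ x) (∑-mono-≤ bound))))
  where
  bound : ∀ y → bool→ℕ (lookup S y) ≤ δ x y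
  bound y with lookup S y in e | y ≟ᶠ x
  ... | false | _ = z≤n
  ... | true | yes refl = ≤-reflexive (sym (δ-refl y))
  ... | true | no y≢x = ⊥-elim (none (y , e , y≢x))

∈-[]≔true : ∀ {n} (S : Subset n) x {y} → lookup S y ≡ true → lookup (S [ x ]≔ true) y ≡ true
∈-[]≔true S x {y} y∈S with y ≟ᶠ x
... | yes refl = lookup∘update y S true
... | no y≢x = trans (lookup∘update′ y≢x S true) y∈S

remove : ∀ {n} → Subset n → Fin n → Subset n
remove S x = S [ x ]≔ false

lookup-remove : ∀ {n} (S : Subset n) x → lookup (remove S x) x ≡ false
lookup-remove S x = lookup∘update x S false

lookup-remove-≢ : ∀ {n} (S : Subset n) {x y} → y ≢ x → lookup (remove S x) y ≡ lookup S y
lookup-remove-≢ S y≢x = lookup∘update′ y≢x S false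

∈-remove⁺ : ∀ {n} (S : Subset n) {x y} → y ≢ x → lookup S y ≡ true → lookup (remove S x) y ≡ true
∈-remove⁺ S y≢x y∈S = trans (lookup-remove-≢ S y≢x) y∈S

∈-remove⁻ : ∀ {n} (S : Subset n) {x y} → lookup (remove S x) y ≡ true → lookup S y ≡ true × y ≢ x
∈-remove⁻ S {x} {y} y∈S-x with y ≟ᶠ x
... | yes refl with () ← trans (sym y∈S-x) (lookup-remove S y)
... | no y≢x = trans (sym (lookup-remove-≢ S y≢x)) y∈S-x , y≢x

∣[]≔∣ : ∀ {n} (S : Subset n) x b → ∣ S [ x ]≔ b ∣ + bool→ℕ (lookup S x) ≡ ∣ S ∣ + bool→ℕ b
∣[]≔∣ S x b = begin
  ∣ S [ x ]≔ b ∣ + bool→ℕ (lookup S x)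
    ≡⟨ cong (_+ bool→ℕ (lookup S x)) (∣S∣≡∑ (S [ x ]≔ b)) ⟩
  ∑ (bool→ℕ ∘ lookup (S [ x ]≔ b)) + bool→ℕ (lookup S x)
    ≡⟨ ∑-update (bool→ℕ ∘ lookup (S [ x ]≔ b)) (bool→ℕ ∘ lookup S) x (λ y y≢x → cong bool→ℕ (lookup∘update′ y≢x S b)) ⟩
  ∑ (bool→ℕ ∘ lookup S) + bool→ℕ (lookup (S [ x ]≔ b) x)
    ≡⟨ cong₂ (λ m c → m + bool→ℕ c) (sym (∣S∣≡∑ S)) (lookup∘update x S b) ⟩
  ∣ S ∣ + bool→ℕ b ∎
  where open ≡-Reasoning

∣remove∣ : ∀ {n} (S : Subset n) x → lookup S x ≡ true → suc ∣ remove S x ∣ ≡ ∣ S ∣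
∣remove∣ S x x∈S = trans (+-comm 1 _) (trans (cong (λ c → ∣ remove S x ∣ + bool→ℕ c) (sym x∈S)) (trans (∣[]≔∣ S x false) (+-identityʳ _)))

remove-injective : ∀ {n} {S T : Subset n} x → lookup S x ≡ true → lookup T x ≡ true →
                   remove S x ≡ remove T x → S ≡ T
remove-injective {S = S} {T} x x∈S x∈T eq = subset-ext pointwise
  where
  pointwise : ∀ y → lookup S y ≡ lookup T y
  pointwise y with y ≟ᶠ x
  ... | yes refl = trans x∈S (sym x∈T)
  ... | no y≢x = trans (sym (lookup-remove-≢ S y≢x)) (trans (cong (λ V → lookup V y) eq) (lookup-remove-≢ T y≢x))

remove-mono : ∀ {n} {S A : Subset n} x → S ⊑ A → remove S x ⊑ remove A x
remove-mono {S = S} {A} x S⊑A y y∈S-x with ∈-remove⁻ S y∈S-x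
... | y∈S , y≢x = ∈-remove⁺ A y≢x (S⊑A y y∈S)

⊑-remove : ∀ {n} {S A : Subset n} x → S ⊑ A → lookup S x ≡ false → S ⊑ remove A x
⊑-remove {S = S} {A} x S⊑A x∉S y y∈S with y ≟ᶠ x
... | yes refl with () ← trans (sym y∈S) x∉S
... | no y≢x = ∈-remove⁺ A y≢x (S⊑A y y∈S)

module _ {a} {X : Set a} where

  private
    delete : ∀ {x : X} {ys : List X} → x ∈ ys → List X
    delete {ys = _ ∷ ys} (here _) = ys
    delete {ys = y ∷ ys} (there x∈ys) = y ∷ delete x∈ys

    length-delete : ∀ {x : X} {ys} (x∈ys : x ∈ ys) → suc (length (delete x∈ys)) ≡ length ys
    length-delete (here _) = refl
    length-delete (there x∈ys) = cong suc (length-delete x∈ys)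

    ∈-delete : ∀ {x y : X} {ys} (x∈ys : x ∈ ys) → y ∈ ys → y ≢ x → y ∈ delete x∈ys
    ∈-delete (here refl) (here refl) y≢x = ⊥-elim (y≢x refl)
    ∈-delete (here refl) (there y∈ys) _ = y∈ys
    ∈-delete (there _) (here y≡) _ = here y≡
    ∈-delete (there x∈ys) (there y∈ys) y≢x = there (∈-delete x∈ys y∈ys y≢x)

  Unique-⊆⇒length≤ : ∀ {xs ys : List X} → Unique xs → xs ⊆ ys → length xs ≤ length ys
  Unique-⊆⇒length≤ {[]} _ _ = z≤n
  Unique-⊆⇒length≤ {x ∷ xs} {ys} (x∉xs ∷ unique) xs⊆ys =
    subst (suc (length xs) ≤_) (length-delete x∈ys)
      (s≤s (Unique-⊆⇒length≤ unique λ {y} y∈xs → ∈-delete x∈ys (xs⊆ys (there y∈xs)) (λ y≡x → lookupAll x∉xs y∈xs (sym y≡x))))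
    where
    x∈ys : x ∈ ys
    x∈ys = xs⊆ys (here refl)
    lookupAll : ∀ {zs} → All (x ≢_) zs → ∀ {z} → z ∈ zs → x ≢ z
    lookupAll (p ∷ _) (here refl) = p
    lookupAll (_ ∷ ps) (there z∈zs) = lookupAll ps z∈zs

  map⁺-injectiveOn : ∀ {b} {Y : Set b} (f : X → Y) {xs : List X} →
                     (∀ {x y} → x ∈ xs → y ∈ xs → f x ≡ f y → x ≡ y) → Unique xs → Unique (map f xs)
  map⁺-injectiveOn f {[]} _ [] = []
  map⁺-injectiveOn f {x ∷ xs} inj (x∉xs ∷ unique) = fresh x∉xs (λ z∈ → z∈) ∷ map⁺-injectiveOn f (λ p q → inj (there p) (there q)) unique
    where
    fresh : ∀ {zs} → All (x ≢_) zs → (∀ {z} → z ∈ zs → z ∈ xs) → All (f x ≢_) (map f zs)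
    fresh [] _ = []
    fresh (x≢z ∷ ps) sub = (x≢z ∘ inj (here refl) (there (sub (here refl)))) ∷ fresh ps (sub ∘ there)

  length-filter-split : ∀ {p} {P : Pred X p} (P? : Decidable P) (xs : List X) →
                        length xs ≡ length (filter P? xs) + length (filter (¬? ∘ P?) xs)
  length-filter-split P? [] = refl
  length-filter-split P? (x ∷ xs) with P? x
  ... | yes _ = cong suc (length-filter-split P? xs)
  ... | no _ = trans (cong suc (length-filter-split P? xs)) (sym (+-suc _ _))

-- The j-element subsets of a finite set

subsetsOfSize : ∀ {n} → Subset n → ℕ → List (Subset n)
subsetsOfSize Vec.[] zero = Vec.[] ∷ []
subsetsOfSize Vec.[] (suc j) = []
subsetsOfSize (false ∷ A) j = map (false ∷_) (subsetsOfSize A j)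
subsetsOfSize (true ∷ A) zero = map (false ∷_) (subsetsOfSize A zero)
subsetsOfSize (true ∷ A) (suc j) = map (false ∷_) (subsetsOfSize A (suc j)) ++ map (true ∷_) (subsetsOfSize A j)

length-subsetsOfSize : ∀ {n} (A : Subset n) j → length (subsetsOfSize A j) ≡ ∣ A ∣ C j
length-subsetsOfSize Vec.[] zero = refl
length-subsetsOfSize Vec.[] (suc j) = refl
length-subsetsOfSize (false ∷ A) j = trans (length-map _ (subsetsOfSize A j)) (length-subsetsOfSize A j)
length-subsetsOfSize (true ∷ A) zero = trans (length-map _ (subsetsOfSize A zero)) (length-subsetsOfSize A zero)
length-subsetsOfSize (true ∷ A) (suc j) = begin
  length (map (false ∷_) (subsetsOfSize A (suc j)) ++ map (true ∷_) (subsetsOfSize A j))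
    ≡⟨ length-++ (map (false ∷_) (subsetsOfSize A (suc j))) ⟩
  length (map (false ∷_) (subsetsOfSize A (suc j))) + length (map (true ∷_) (subsetsOfSize A j))
    ≡⟨ cong₂ _+_ (trans (length-map _ (subsetsOfSize A (suc j))) (length-subsetsOfSize A (suc j)))
                 (trans (length-map _ (subsetsOfSize A j)) (length-subsetsOfSize A j)) ⟩
  ∣ A ∣ C suc j + ∣ A ∣ C j  ≡⟨ +-comm (∣ A ∣ C suc j) _ ⟩
  ∣ A ∣ C j + ∣ A ∣ C suc j  ≡⟨ nCk+nC[k+1]≡[n+1]C[k+1] ∣ A ∣ j ⟩
  suc ∣ A ∣ C suc j          ∎
  where open ≡-Reasoning

subsetsOfSize-complete : ∀ {n} (A S : Subset n) j → S ⊑ A → ∣ S ∣ ≡ j → S ∈ subsetsOfSize A j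
subsetsOfSize-complete Vec.[] Vec.[] zero _ _ = here refl
subsetsOfSize-complete (false ∷ A) (false ∷ S) j S⊑A ∣S∣≡j = ∈-map⁺ (false ∷_) (subsetsOfSize-complete A S j (S⊑A ∘ suc) ∣S∣≡j)
subsetsOfSize-complete (false ∷ A) (true ∷ S) j S⊑A _ with () ← S⊑A zero refl
subsetsOfSize-complete (true ∷ A) (false ∷ S) zero S⊑A ∣S∣≡j = ∈-map⁺ (false ∷_) (subsetsOfSize-complete A S zero (S⊑A ∘ suc) ∣S∣≡j)
subsetsOfSize-complete (true ∷ A) (false ∷ S) (suc j) S⊑A ∣S∣≡j =
  ∈-++⁺ˡ (∈-map⁺ (false ∷_) (subsetsOfSize-complete A S (suc j) (S⊑A ∘ suc) ∣S∣≡j))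
subsetsOfSize-complete (true ∷ A) (true ∷ S) (suc j) S⊑A ∣S∣≡j =
  ∈-++⁺ʳ (map (false ∷_) (subsetsOfSize A (suc j))) (∈-map⁺ (true ∷_) (subsetsOfSize-complete A S j (S⊑A ∘ suc) (suc-injective ∣S∣≡j)))

false∷-⊑ : ∀ {n} c {S A : Subset n} → S ⊑ A → (false ∷ S) ⊑ (c ∷ A)
false∷-⊑ c S⊑A (suc x) = S⊑A x

true∷-⊑ : ∀ {n} {S A : Subset n} → S ⊑ A → (true ∷ S) ⊑ (true ∷ A)
true∷-⊑ S⊑A zero _ = refl
true∷-⊑ S⊑A (suc x) = S⊑A x

subsetsOfSize-sound : ∀ {n} (A : Subset n) j S → S ∈ subsetsOfSize A j → S ⊑ A × ∣ S ∣ ≡ j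
subsetsOfSize-sound Vec.[] zero Vec.[] _ = (λ ()) , refl
subsetsOfSize-sound (false ∷ A) j S S∈ with T , T∈ , refl ← ∈-map⁻ (false ∷_) S∈ =
  map₁ (false∷-⊑ false) (subsetsOfSize-sound A j T T∈)
subsetsOfSize-sound (true ∷ A) zero S S∈ with T , T∈ , refl ← ∈-map⁻ (false ∷_) S∈ =
  map₁ (false∷-⊑ true) (subsetsOfSize-sound A zero T T∈)
subsetsOfSize-sound (true ∷ A) (suc j) S S∈ with ∈-++⁻ (map (false ∷_) (subsetsOfSize A (suc j))) S∈
... | inj₁ S∈₀ with T , T∈ , refl ← ∈-map⁻ (false ∷_) S∈₀ = map₁ (false∷-⊑ true) (subsetsOfSize-sound A (suc j) T T∈)
... | inj₂ S∈₁ with T , T∈ , refl ← ∈-map⁻ (true ∷_) S∈₁ = Data.Product.map true∷-⊑ (cong suc) (subsetsOfSize-sound A j T T∈)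

subsetsOfSize-unique : ∀ {n} (A : Subset n) j → Unique (subsetsOfSize A j)
subsetsOfSize-unique Vec.[] zero = [] ∷ []
subsetsOfSize-unique Vec.[] (suc j) = []
subsetsOfSize-unique (false ∷ A) j = map⁺ ∷-injectiveʳ (subsetsOfSize-unique A j)
subsetsOfSize-unique (true ∷ A) zero = map⁺ ∷-injectiveʳ (subsetsOfSize-unique A zero)
subsetsOfSize-unique (true ∷ A) (suc j) =
  ++⁺ (map⁺ ∷-injectiveʳ (subsetsOfSize-unique A (suc j))) (map⁺ ∷-injectiveʳ (subsetsOfSize-unique A j)) disjoint
  where
  disjoint : ∀ {S} → ¬ (S ∈ map (false ∷_) (subsetsOfSize A (suc j)) × S ∈ map (true ∷_) (subsetsOfSize A j))
  disjoint (S∈₀ , S∈₁) with ∈-map⁻ (false ∷_) S∈₀ | ∈-map⁻ (true ∷_) S∈₁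
  ... | _ , _ , refl | _ , _ , ()

length≤C : ∀ {n} (A : Subset n) j (L : List (Subset n)) → Unique L →
           (∀ S → S ∈ L → S ⊑ A × ∣ S ∣ ≡ j) → length L ≤ ∣ A ∣ C j
length≤C A j L unique family = subst (length L ≤_) (length-subsetsOfSize A j)
  (Unique-⊆⇒length≤ unique λ {S} S∈L → subsetsOfSize-complete A S j (proj₁ (family S S∈L)) (proj₂ (family S S∈L)))

1≤C : ∀ {m k} → k ≤ m → 1 ≤ m C k
1≤C {m} {zero} _ = ≤-refl
1≤C {suc m} {suc k} (s≤s k≤m) = subst (1 ≤_) (nCk+nC[k+1]≡[n+1]C[k+1] m k) (≤-trans (1≤C k≤m) (m≤m+n _ _))

m≤mCk : ∀ {m k} → 1 ≤ k → k < m → m ≤ m C k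
m≤mCk {suc m} {suc zero} _ _ = ≤-reflexive (sym (nC1≡n (suc m)))
m≤mCk {suc m} {suc (suc k)} _ (s≤s 2+k≤m) = subst (suc m ≤_) (nCk+nC[k+1]≡[n+1]C[k+1] m (suc k))
  (subst (_≤ m C suc k + m C suc (suc k)) (+-comm m 1) (+-mono-≤ (m≤mCk (s≤s z≤n) 2+k≤m) (1≤C 2+k≤m)))

m+k≤mCk : ∀ {m k} → 2 ≤ k → k + 2 ≤ m → m + k ≤ m C k
m+k≤mCk {suc m} {suc zero} (s≤s ()) _
m+k≤mCk {suc m} {suc (suc k)} _ (s≤s 1+k+2≤m) = begin
  suc m + suc (suc k)            ≡⟨ trans (cong (m +_) (+-comm (suc k) 2)) (+-suc m (suc (suc k))) ⟨
  m + (suc k + 2)                ≤⟨ +-monoʳ-≤ m 1+k+2≤m ⟩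
  m + m                          ≤⟨ +-mono-≤ (m≤mCk (s≤s z≤n) (≤-trans (n≤1+n _) 3+k≤m)) (m≤mCk (s≤s z≤n) 3+k≤m) ⟩
  m C suc k + m C suc (suc k)    ≡⟨ nCk+nC[k+1]≡[n+1]C[k+1] m (suc k) ⟩
  suc m C suc (suc k)            ∎
  where
  open ≤-Reasoning
  3+k≤m : 3 + k ≤ m
  3+k≤m = ≤-trans (≤-reflexive (+-comm 2 (suc k))) 1+k+2≤m

module _ {n : ℕ} (G : Graph n) where

  Adj-sym : ∀ {x y} → Adj G x y → Adj G y x
  Adj-sym {x} {y} x~y = trans (sym (Graph.sym G x y)) x~y

  Adj-irrefl : ∀ {x y} → Adj G x y → x ≢ y
  Adj-irrefl {x} x~x refl with () ← trans (sym x~x) (Graph.irrefl G x)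

  data WalkIn (S : Subset n) : Fin n → Fin n → Set where
    done : ∀ {x} → WalkIn S x x
    edge : ∀ {x y z} → Adj G x y → lookup S y ≡ true → WalkIn S y z → WalkIn S x z

  WalkIn-trans : ∀ {S x y z} → WalkIn S x y → WalkIn S y z → WalkIn S x z
  WalkIn-trans done w = w
  WalkIn-trans (edge x~y y∈S w) v = edge x~y y∈S (WalkIn-trans w v)

  WalkIn-sym : ∀ {S x y} → lookup S x ≡ true → WalkIn S x y → WalkIn S y x
  WalkIn-sym x∈S done = done
  WalkIn-sym x∈S (edge x~y y∈S w) = WalkIn-trans (WalkIn-sym y∈S w) (edge (Adj-sym x~y) x∈S done)

  ConnectedIn : Subset n → Set
  ConnectedIn A = ∀ x y → lookup A x ≡ true → lookup A y ≡ true → WalkIn A x y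

  deg : Subset n → Fin n → ℕ
  deg A x = ∑ (λ y → bool→ℕ (lookup A y ∧ adj G x y))

  degIn : Subset n → Fin n → ℕ
  degIn A x = if lookup A x then deg A x else 0

  -- By the handshake lemma the second component says that G[A] has ∣ A ∣ edges.
  UnicyclicOn : Subset n → Set
  UnicyclicOn A = ConnectedIn A × ∑ (degIn A) ≡ 2 * ∣ A ∣

  IsLeaf : Subset n → Fin n → Set
  IsLeaf A l = lookup A l ≡ true × deg A l ≡ 1

  HasLeaf : Subset n → Set
  HasLeaf A = ∃ (IsLeaf A)

  hasLeaf? : ∀ A → Dec (HasLeaf A)
  hasLeaf? A = any? (λ l → (lookup A l ≟ᵇ true) ×-dec (deg A l ≟ 1))

  deg-term≡1 : ∀ {A x y} → lookup A y ≡ true → Adj G x y → bool→ℕ (lookup A y ∧ adj G x y) ≡ 1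
  deg-term≡1 y∈A x~y rewrite y∈A | x~y = refl

  1≤deg⇒neighbour : ∀ {A x} → 1 ≤ deg A x → ∃ λ u → lookup A u ≡ true × Adj G x u
  1≤deg⇒neighbour {A} {x} 1≤d with ∑>0⇒∃>0 (λ y → bool→ℕ (lookup A y ∧ adj G x y)) 1≤d
  ... | u , p = u , ∧-conicalˡ _ _ (bool→ℕ≥1⇒true p) , ∧-conicalʳ _ _ (bool→ℕ≥1⇒true p)

  neighbour⇒1≤deg : ∀ {A x u} → lookup A u ≡ true → Adj G x u → 1 ≤ deg A x
  neighbour⇒1≤deg {A} {x} {u} u∈A x~u =
    subst (_≤ deg A x) (deg-term≡1 {A} u∈A x~u) (f≤∑f (λ y → bool→ℕ (lookup A y ∧ adj G x y)) u)

  two-neighbours⇒2≤deg : ∀ {A x u v} → u ≢ v → lookup A u ≡ true → Adj G x u →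
                         lookup A v ≡ true → Adj G x v → 2 ≤ deg A x
  two-neighbours⇒2≤deg {A} {x} {u} {v} u≢v u∈A x~u v∈A x~v =
    subst (_≤ deg A x) (cong₂ _+_ (deg-term≡1 {A} u∈A x~u) (deg-term≡1 {A} v∈A x~v))
      (f+f≤∑f (λ y → bool→ℕ (lookup A y ∧ adj G x y)) u v u≢v)

  deg≡1⇒neighbour-unique : ∀ {A x u v} → deg A x ≡ 1 → lookup A u ≡ true → Adj G x u →
                           lookup A v ≡ true → Adj G x v → u ≡ v
  deg≡1⇒neighbour-unique {A} d≡1 u∈A x~u v∈A x~v with _ ≟ᶠ _
  ... | yes u≡v = u≡v
  ... | no u≢v = ⊥-elim (<⇒≱ (s≤s (s≤s z≤n)) (subst (2 ≤_) d≡1 (two-neighbours⇒2≤deg {A} u≢v u∈A x~u v∈A x~v)))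

  ConnectedIn⇒1≤deg : ∀ {A x y} → ConnectedIn A → lookup A x ≡ true → lookup A y ≡ true → x ≢ y → 1 ≤ deg A x
  ConnectedIn⇒1≤deg {A} {x} {y} connected x∈A y∈A x≢y with connected x y x∈A y∈A
  ... | done = ⊥-elim (x≢y refl)
  ... | edge x~u u∈A _ = neighbour⇒1≤deg {A} u∈A x~u

  ⊑N[c]⇒∣∣≤1+deg : ∀ {A c} → (∀ y → lookup A y ≡ true → c ≡ y ⊎ Adj G c y) → ∣ A ∣ ≤ suc (deg A c)
  ⊑N[c]⇒∣∣≤1+deg {A} {c} closed =
    subst₂ _≤_ (sym (∣S∣≡∑ A)) (trans (∑-+ (δ c) _) (cong (_+ deg A c) (∑-δ c))) (∑-mono-≤ pointwise)
    where
    pointwise : ∀ y → bool→ℕ (lookup A y) ≤ δ c y + bool→ℕ (lookup A y ∧ adj G c y)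
    pointwise y with lookup A y in y∈A
    ... | false = z≤n
    ... | true with closed y y∈A
    ...   | inj₁ refl = ≤-trans (≤-reflexive (sym (δ-refl c))) (m≤m+n _ _)
    ...   | inj₂ c~y rewrite c~y = m≤n+m _ _

  deg-remove : ∀ A l x → lookup A l ≡ true → deg (remove A l) x + bool→ℕ (adj G x l) ≡ deg A x
  deg-remove A l x l∈A = begin
    deg (remove A l) x + bool→ℕ (adj G x l)
      ≡⟨ cong (λ b → deg (remove A l) x + bool→ℕ (b ∧ adj G x l)) l∈A ⟨
    deg (remove A l) x + bool→ℕ (lookup A l ∧ adj G x l)
      ≡⟨ ∑-update _ _ l (λ y y≢l → cong (λ b → bool→ℕ (b ∧ adj G x y)) (lookup-remove-≢ A y≢l)) ⟩
    deg A x + bool→ℕ (lookup (remove A l) l ∧ adj G x l)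
      ≡⟨ cong (λ b → deg A x + bool→ℕ (b ∧ adj G x l)) (lookup-remove A l) ⟩
    deg A x + 0
      ≡⟨ +-identityʳ _ ⟩
    deg A x ∎
    where open ≡-Reasoning

  module LeafRemoval {A : Subset n} {l : Fin n} (unicyclic : UnicyclicOn A) (leaf : IsLeaf A l) where

    private
      l∈A : lookup A l ≡ true
      l∈A = proj₁ leaf
      deg-l : deg A l ≡ 1
      deg-l = proj₂ leaf
      neighbour : ∃ λ u → lookup A u ≡ true × Adj G l u
      neighbour = 1≤deg⇒neighbour {A} (≤-reflexive (sym deg-l))

    u : Fin n
    u = proj₁ neighbour

    u∈A : lookup A u ≡ true
    u∈A = proj₁ (proj₂ neighbour)

    l~u : Adj G l u
    l~u = proj₂ (proj₂ neighbour)

    u≢l : u ≢ l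
    u≢l = Adj-irrefl l~u ∘ sym

    neighbour-unique : ∀ {v} → lookup A v ≡ true → Adj G l v → v ≡ u
    neighbour-unique v∈A l~v = deg≡1⇒neighbour-unique {A} deg-l v∈A l~v u∈A l~u

    u∈A-l : lookup (remove A l) u ≡ true
    u∈A-l = ∈-remove⁺ A u≢l u∈A

    ∣A-l∣ : suc ∣ remove A l ∣ ≡ ∣ A ∣
    ∣A-l∣ = ∣remove∣ A l l∈A

    -- A walk entering the leaf l must leave it through u again, so l can be cut out.
    avoid-leaf : ∀ {x y} → lookup A x ≡ true → y ≢ l → WalkIn A x y →
                 (x ≢ l → WalkIn (remove A l) x y) × (x ≡ l → WalkIn (remove A l) u y)
    avoid-leaf x∈A y≢l done = (λ _ → done) , (λ x≡l → ⊥-elim (y≢l x≡l))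
    avoid-leaf {x} {y} x∈A y≢l (edge {y = x′} x~x′ x′∈A w) = fromOther , fromLeaf
      where
      ih : (x′ ≢ l → WalkIn (remove A l) x′ y) × (x′ ≡ l → WalkIn (remove A l) u y)
      ih = avoid-leaf x′∈A y≢l w
      fromLeaf : x ≡ l → WalkIn (remove A l) u y
      fromLeaf refl = subst (λ z → WalkIn (remove A l) z y) (neighbour-unique x′∈A x~x′)
                        (proj₁ ih (u≢l ∘ trans (sym (neighbour-unique x′∈A x~x′))))
      fromOther : x ≢ l → WalkIn (remove A l) x y
      fromOther x≢l with x′ ≟ᶠ l
      ... | no x′≢l = edge x~x′ (∈-remove⁺ A x′≢l x′∈A) (proj₁ ih x′≢l)
      ... | yes refl = subst (λ z → WalkIn (remove A l) z y) (sym (neighbour-unique x∈A (Adj-sym x~x′))) (proj₂ ih refl)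

    ConnectedIn-remove : ConnectedIn (remove A l)
    ConnectedIn-remove x y x∈A-l y∈A-l with ∈-remove⁻ A x∈A-l | ∈-remove⁻ A y∈A-l
    ... | x∈A , x≢l | y∈A , y≢l = proj₁ (avoid-leaf x∈A y≢l (proj₁ unicyclic x y x∈A y∈A)) x≢l

    degIn-remove : ∀ x → degIn A x ≡ degIn (remove A l) x + bool→ℕ (lookup (remove A l) x ∧ adj G l x) + δ l x * deg A l
    degIn-remove x with x ≟ᶠ l
    ... | yes refl rewrite l∈A | lookup-remove A x | δ-refl x = sym (+-identityʳ _)
    ... | no x≢l rewrite lookup-remove-≢ A x≢l | δ-≢ (x≢l ∘ sym) with lookup A x
    ...   | false = refl
    ...   | true = trans (sym (deg-remove A l x l∈A)) (trans (cong (λ b → deg (remove A l) x + bool→ℕ b) (Graph.sym G x l)) (sym (+-identityʳ _)))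

    deg-l-remove : deg (remove A l) l ≡ 1
    deg-l-remove = begin
      deg (remove A l) l                          ≡⟨ +-identityʳ _ ⟨
      deg (remove A l) l + 0                      ≡⟨ cong (λ b → deg (remove A l) l + bool→ℕ b) (Graph.irrefl G l) ⟨
      deg (remove A l) l + bool→ℕ (adj G l l)     ≡⟨ deg-remove A l l l∈A ⟩
      deg A l                                     ≡⟨ deg-l ⟩
      1                                           ∎
      where open ≡-Reasoning

    ∑degIn-remove : ∑ (degIn A) ≡ ∑ (degIn (remove A l)) + 2
    ∑degIn-remove = begin
      ∑ (degIn A)
        ≡⟨ ∑-cong degIn-remove ⟩
      ∑ (λ x → degIn (remove A l) x + bool→ℕ (lookup (remove A l) x ∧ adj G l x) + δ l x * deg A l)
        ≡⟨ ∑-+ _ (λ x → δ l x * deg A l) ⟩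
      ∑ (λ x → degIn (remove A l) x + bool→ℕ (lookup (remove A l) x ∧ adj G l x)) + ∑ (λ x → δ l x * deg A l)
        ≡⟨ cong₂ _+_ (∑-+ (degIn (remove A l)) _) (trans (∑-*ʳ (δ l) _) (trans (cong (_* deg A l) (∑-δ l)) (trans (+-identityʳ _) deg-l))) ⟩
      ∑ (degIn (remove A l)) + deg (remove A l) l + 1
        ≡⟨ cong (λ t → ∑ (degIn (remove A l)) + t + 1) deg-l-remove ⟩
      ∑ (degIn (remove A l)) + 1 + 1
        ≡⟨ +-assoc (∑ (degIn (remove A l))) 1 1 ⟩
      ∑ (degIn (remove A l)) + 2 ∎
      where open ≡-Reasoning

    UnicyclicOn-remove : UnicyclicOn (remove A l)
    UnicyclicOn-remove = ConnectedIn-remove , +-cancelʳ-≡ 2 _ _ (trans (sym ∑degIn-remove) (trans (proj₂ unicyclic) twice))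
      where
      twice : 2 * ∣ A ∣ ≡ 2 * ∣ remove A l ∣ + 2
      twice = trans (cong (2 *_) (sym ∣A-l∣)) (trans (*-suc 2 ∣ remove A l ∣) (+-comm 2 _))

  leafless⇒deg≡2 : ∀ {A} → UnicyclicOn A → ¬ HasLeaf A → 2 ≤ ∣ A ∣ → ∀ x → lookup A x ≡ true → deg A x ≡ 2
  leafless⇒deg≡2 {A} (connected , degrees) leafless 2≤∣A∣ x x∈A =
    atX (∑-mono-≤-tight 2≤degIn sums x)
    where
    2≤deg : ∀ z → lookup A z ≡ true → 2 ≤ deg A z
    2≤deg z z∈A with deg A z ≟ 1 | ∃∈≢ A z 2≤∣A∣
    ... | yes d≡1 | _ = ⊥-elim (leafless (z , z∈A , d≡1))
    ... | no d≢1 | y , y∈A , y≢z = ≤∧≢⇒< (ConnectedIn⇒1≤deg connected z∈A y∈A (y≢z ∘ sym)) (d≢1 ∘ sym)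
    2≤degIn : ∀ z → (if lookup A z then 2 else 0) ≤ degIn A z
    2≤degIn z with lookup A z in z∈A
    ... | true = 2≤deg z z∈A
    ... | false = z≤n
    sums : ∑ (λ z → if lookup A z then 2 else 0) ≡ ∑ (degIn A)
    sums = begin
      ∑ (λ z → if lookup A z then 2 else 0)  ≡⟨ ∑-cong (λ z → two-or-zero (lookup A z)) ⟩
      ∑ (λ z → bool→ℕ (lookup A z) * 2)     ≡⟨ ∑-*ʳ (bool→ℕ ∘ lookup A) 2 ⟩
      ∑ (bool→ℕ ∘ lookup A) * 2             ≡⟨ cong (_* 2) (∣S∣≡∑ A) ⟨
      ∣ A ∣ * 2                             ≡⟨ *-comm ∣ A ∣ 2 ⟩
      2 * ∣ A ∣                             ≡⟨ degrees ⟨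
      ∑ (degIn A)                           ∎
      where
      open ≡-Reasoning
      two-or-zero : ∀ b → (if b then 2 else 0) ≡ bool→ℕ b * 2
      two-or-zero true = refl
      two-or-zero false = refl
    atX : (if lookup A x then 2 else 0) ≡ degIn A x → deg A x ≡ 2
    atX eq rewrite x∈A = sym eq

module _ {n : ℕ} (G : Graph n) where

  CopWinsFrom⇒WalkIn : ∀ {S c r} → lookup S r ≡ true → CopWinsFrom G S c r → WalkIn G S c r
  CopWinsFrom⇒WalkIn {S} {c} {r} r∈S (move c′ c′∈S c≈c′ continue) = first c≈c′ (rest continue)
    where
    first : Close G c c′ → WalkIn G S c′ r → WalkIn G S c r
    first (inj₁ refl) w = w
    first (inj₂ c~c′) w = edge c~c′ ([]=⇒lookup c′∈S) w
    rest : (c′ ≡ r) ⊎ (∀ r′ → r′ ∈ₛ S → Close G r r′ → (r′ ≡ c′) ⊎ CopWinsFrom G S c′ r′) → WalkIn G S c′ r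
    rest (inj₁ refl) = done
    rest (inj₂ reply) with reply r (lookup⇒[]= r S r∈S) (inj₁ refl)
    ... | inj₁ refl = done
    ... | inj₂ win = CopWinsFrom⇒WalkIn r∈S win

  CopWin⇒ConnectedIn : ∀ {S} → CopWin G S → ConnectedIn G S
  CopWin⇒ConnectedIn {S} (c , c∈S , strategy) x y x∈S y∈S =
    WalkIn-trans G (WalkIn-sym G ([]=⇒lookup c∈S) (fromCop x∈S)) (fromCop y∈S)
    where
    fromCop : ∀ {z} → lookup S z ≡ true → WalkIn G S c z
    fromCop {z} z∈S with strategy z (lookup⇒[]= z S z∈S)
    ... | inj₁ refl = done
    ... | inj₂ win = CopWinsFrom⇒WalkIn z∈S win

  CopWin⇒nonempty : ∀ {S} → CopWin G S → ∃ λ c → lookup S c ≡ true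
  CopWin⇒nonempty (c , c∈S , _) = c , []=⇒lookup c∈S

  CopWinSubset : Subset n → ℕ → Subset n → Set
  CopWinSubset A i S = S ⊑ A × ∣ S ∣ ≡ i × CopWin G S

  ¬CopWinSubset-0 : ∀ {A S} → ¬ CopWinSubset A 0 S
  ¬CopWinSubset-0 {S = S} (_ , ∣S∣≡0 , copWin) with CopWin⇒nonempty copWin
  ... | c , c∈S with () ← subst (1 ≤_) ∣S∣≡0 (∈⇒1≤∣∣ S c∈S)

  dominating⇒CopWin : ∀ S c → lookup S c ≡ true → (∀ r → lookup S r ≡ true → r ≢ c → Adj G c r) → CopWin G S
  dominating⇒CopWin S c c∈S dominates = c , lookup⇒[]= c S c∈S , capture
    where
    capture : ∀ r → r ∈ₛ S → (c ≡ r) ⊎ CopWinsFrom G S c r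
    capture r r∈S with r ≟ᶠ c
    ... | yes r≡c = inj₁ (sym r≡c)
    ... | no r≢c = inj₂ (move r r∈S (inj₂ (dominates r ([]=⇒lookup r∈S) r≢c)) (inj₁ refl))

  -- The cop plays the image of his strategy under the retraction l ↦ u; the robber never stands on l.
  CopWin-remove-pendant : ∀ {S l u} → lookup S u ≡ true → u ≢ l →
                          (∀ v → lookup S v ≡ true → Adj G l v → v ≡ u) → CopWin G S → CopWin G (remove S l)
  CopWin-remove-pendant {S} {l} {u} u∈S u≢l pendant (c₀ , c₀∈S , strategy) =
    φ c₀ , lookup⇒[]= (φ c₀) (remove S l) (φ∈ ([]=⇒lookup c₀∈S)) , start
    where
    φ : Fin n → Fin n
    φ c with c ≟ᶠ l
    ... | yes _ = u
    ... | no _ = c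

    φ-≢ : ∀ {c} → c ≢ l → φ c ≡ c
    φ-≢ {c} c≢l with c ≟ᶠ l
    ... | yes c≡l = ⊥-elim (c≢l c≡l)
    ... | no _ = refl

    φ∈ : ∀ {c} → lookup S c ≡ true → lookup (remove S l) (φ c) ≡ true
    φ∈ {c} c∈S with c ≟ᶠ l
    ... | yes _ = ∈-remove⁺ S u≢l u∈S
    ... | no c≢l = ∈-remove⁺ S c≢l c∈S

    φ-Close : ∀ {c c′} → lookup S c ≡ true → lookup S c′ ≡ true → Close G c c′ → Close G (φ c) (φ c′)
    φ-Close {c} {c′} c∈S c′∈S c≈c′ with c ≟ᶠ l | c′ ≟ᶠ l | c≈c′
    ... | yes refl | yes refl | _ = inj₁ refl
    ... | yes refl | no c′≢l | inj₁ c≡c′ = ⊥-elim (c′≢l (sym c≡c′))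
    ... | yes refl | no _ | inj₂ l~c′ = inj₁ (sym (pendant c′ c′∈S l~c′))
    ... | no c≢l | yes refl | inj₁ c≡c′ = ⊥-elim (c≢l c≡c′)
    ... | no _ | yes refl | inj₂ c~l = inj₁ (pendant c c∈S (Adj-sym G c~l))
    ... | no _ | no _ | _ = c≈c′

    shadow : ∀ {c r} → lookup S c ≡ true → lookup S r ≡ true → r ≢ l →
             CopWinsFrom G S c r → CopWinsFrom G (remove S l) (φ c) r
    shadow {c} {r} c∈S r∈S r≢l (move c′ c′∈S c≈c′ continue) =
      move (φ c′) (lookup⇒[]= (φ c′) (remove S l) (φ∈ ([]=⇒lookup c′∈S))) (φ-Close c∈S ([]=⇒lookup c′∈S) c≈c′) (shadowed continue)
      where
      shadowed : (c′ ≡ r) ⊎ (∀ r′ → r′ ∈ₛ S → Close G r r′ → (r′ ≡ c′) ⊎ CopWinsFrom G S c′ r′) →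
                 (φ c′ ≡ r) ⊎ (∀ r′ → r′ ∈ₛ remove S l → Close G r r′ → (r′ ≡ φ c′) ⊎ CopWinsFrom G (remove S l) (φ c′) r′)
      shadowed (inj₁ refl) = inj₁ (φ-≢ r≢l)
      shadowed (inj₂ reply) = inj₂ reply′
        where
        reply′ : ∀ r′ → r′ ∈ₛ remove S l → Close G r r′ → (r′ ≡ φ c′) ⊎ CopWinsFrom G (remove S l) (φ c′) r′
        reply′ r′ r′∈S-l r≈r′ with ∈-remove⁻ S ([]=⇒lookup r′∈S-l)
        ... | r′∈S , r′≢l with reply r′ (lookup⇒[]= r′ S r′∈S) r≈r′
        ...   | inj₁ refl = inj₁ (sym (φ-≢ r′≢l))
        ...   | inj₂ win = inj₂ (shadow ([]=⇒lookup c′∈S) r′∈S r′≢l win)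

    start : ∀ r → r ∈ₛ remove S l → (φ c₀ ≡ r) ⊎ CopWinsFrom G (remove S l) (φ c₀) r
    start r r∈S-l with ∈-remove⁻ S ([]=⇒lookup r∈S-l)
    ... | r∈S , r≢l with strategy r (lookup⇒[]= r S r∈S)
    ...   | inj₁ refl = inj₁ (φ-≢ r≢l)
    ...   | inj₂ win = inj₂ (shadow ([]=⇒lookup c₀∈S) r∈S r≢l win)

  robberEscapes⇒¬CopWin : ∀ S →
    (∀ c → lookup S c ≡ true → ∃ λ r → lookup S r ≡ true × c ≢ r × ¬ Adj G c r) →
    (∀ c r → lookup S c ≡ true → lookup S r ≡ true → c ≢ r →
       ∃ λ r′ → lookup S r′ ≡ true × Close G r r′ × r′ ≢ c × ¬ Adj G c r′) →
    ¬ CopWin G S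
  robberEscapes⇒¬CopWin S undominated escape (c₀ , c₀∈S , strategy) with undominated c₀ ([]=⇒lookup c₀∈S)
  ... | r , r∈S , c₀≢r , c₀≁r with strategy r (lookup⇒[]= r S r∈S)
  ...   | inj₁ c₀≡r = c₀≢r c₀≡r
  ...   | inj₂ win = safe r∈S c₀≢r c₀≁r win
    where
    notClose : ∀ {c r} → Close G c r → c ≢ r → ¬ Adj G c r → ⊥
    notClose (inj₁ c≡r) c≢r _ = c≢r c≡r
    notClose (inj₂ c~r) _ c≁r = c≁r c~r
    safe : ∀ {c r} → lookup S r ≡ true → c ≢ r → ¬ Adj G c r → ¬ CopWinsFrom G S c r
    safe r∈S c≢r c≁r (move c′ c′∈S c≈c′ (inj₁ refl)) = notClose c≈c′ c≢r c≁r
    safe {r = r} r∈S c≢r c≁r (move c′ c′∈S c≈c′ (inj₂ reply))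
      with escape c′ r ([]=⇒lookup c′∈S) r∈S (λ { refl → notClose c≈c′ c≢r c≁r })
    ... | r′ , r′∈S , r≈r′ , r′≢c′ , c′≁r′ with reply r′ (lookup⇒[]= r′ S r′∈S) r≈r′
    ...   | inj₁ r′≡c′ = r′≢c′ r′≡c′
    ...   | inj₂ win = safe r′∈S (r′≢c′ ∘ sym) c′≁r′ win

-- Leafless unicyclic subgraphs are cycles

module LeaflessUnicyclic {n : ℕ} (G : Graph n) {A : Subset n} (unicyclic : UnicyclicOn G A)
                         (leafless : ¬ HasLeaf G A) (4≤∣A∣ : 4 ≤ ∣ A ∣) where

  k : ℕ
  k = ∣ A ∣

  deg≡2 : ∀ x → lookup A x ≡ true → deg G A x ≡ 2
  deg≡2 = leafless⇒deg≡2 G unicyclic leafless (≤-trans (s≤s (s≤s z≤n)) 4≤∣A∣)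

  ∃neighbour≢ : ∀ {x v} → lookup A x ≡ true → lookup A v ≡ true → ∃ λ w → lookup A w ≡ true × Adj G x w × w ≢ v
  ∃neighbour≢ {x} {v} x∈A v∈A with 1≤deg⇒neighbour G {remove A v} 1≤deg
    where
    1≤deg : 1 ≤ deg G (remove A v) x
    1≤deg = +-cancelʳ-≤ 1 1 _ (≤-trans (≤-reflexive (trans (sym (deg≡2 x x∈A)) (sym (deg-remove G A v x v∈A))))
                                        (+-monoʳ-≤ (deg G (remove A v) x) (bool→ℕ≤1 (adj G x v))))
      where
      bool→ℕ≤1 : ∀ b → bool→ℕ b ≤ 1
      bool→ℕ≤1 true = ≤-refl
      bool→ℕ≤1 false = z≤n
  ... | w , w∈A-v , x~w = w , proj₁ (∈-remove⁻ A w∈A-v) , x~w , proj₂ (∈-remove⁻ A w∈A-v)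

  neighbour-of-two : ∀ {x v w y} → lookup A x ≡ true → v ≢ w → lookup A v ≡ true → Adj G x v →
                     lookup A w ≡ true → Adj G x w → lookup A y ≡ true → Adj G x y → y ≡ v ⊎ y ≡ w
  neighbour-of-two {x} {v} {w} {y} x∈A v≢w v∈A x~v w∈A x~w y∈A x~y with y ≟ᶠ v | y ≟ᶠ w
  ... | yes y≡v | _ = inj₁ y≡v
  ... | no _ | yes y≡w = inj₂ y≡w
  ... | no y≢v | no y≢w = ⊥-elim (<⇒≱ (s≤s (s≤s z≤n)) (+-cancelʳ-≤ 1 2 1 3≤2))
    where
    3≤2 : 2 + 1 ≤ 1 + 1
    3≤2 = begin
      2 + 1                                        ≤⟨ +-monoˡ-≤ 1 (two-neighbours⇒2≤deg G {remove A y} v≢w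
                                                        (∈-remove⁺ A (y≢v ∘ sym) v∈A) x~v (∈-remove⁺ A (y≢w ∘ sym) w∈A) x~w) ⟩
      deg G (remove A y) x + 1                     ≡⟨ cong (λ b → deg G (remove A y) x + bool→ℕ b) x~y ⟨
      deg G (remove A y) x + bool→ℕ (adj G x y)    ≡⟨ deg-remove G A y x y∈A ⟩
      deg G A x                                    ≡⟨ deg≡2 x x∈A ⟩
      2                                            ∎
      where open ≤-Reasoning

  undominated : ∀ c → lookup A c ≡ true → ∃ λ r → lookup A r ≡ true × c ≢ r × ¬ Adj G c r
  undominated c c∈A with any? (λ r → (lookup A r ≟ᵇ true) ×-dec (¬? (c ≟ᶠ r) ×-dec ¬? (adj G c r ≟ᵇ true)))
  ... | yes witness = witness
  ... | no none = ⊥-elim (<⇒≱ 4≤∣A∣ (subst (k ≤_) (cong suc (deg≡2 c c∈A)) (⊑N[c]⇒∣∣≤1+deg G {A} closed)))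
    where
    closed : ∀ y → lookup A y ≡ true → c ≡ y ⊎ Adj G c y
    closed y y∈A with c ≟ᶠ y | adj G c y in c~y
    ... | yes c≡y | _ = inj₁ c≡y
    ... | no _ | true = inj₂ refl
    ... | no c≢y | false = ⊥-elim (none (y , y∈A , c≢y , λ c~y′ → contradiction (trans (sym c~y′) c~y) λ ()))

  triangle⇒∣A∣≤3 : ∀ {c r w} → lookup A c ≡ true → lookup A r ≡ true → lookup A w ≡ true →
                   Adj G c r → Adj G c w → Adj G r w → k ≤ 3
  triangle⇒∣A∣≤3 {c} {r} {w} c∈A r∈A w∈A c~r c~w r~w =
    subst (k ≤_) (cong suc (deg≡2 c c∈A)) (⊑N[c]⇒∣∣≤1+deg G {A} closed)
    where
    OnTriangle : Fin n → Set
    OnTriangle y = y ≡ c ⊎ y ≡ r ⊎ y ≡ w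
    stay : ∀ {x y} → OnTriangle x → lookup A y ≡ true → Adj G x y → OnTriangle y
    stay (inj₁ refl) y∈A x~y = inj₂ (neighbour-of-two c∈A (Adj-irrefl G r~w) r∈A c~r w∈A c~w y∈A x~y)
    stay (inj₂ (inj₁ refl)) y∈A x~y with neighbour-of-two r∈A (Adj-irrefl G c~w) c∈A (Adj-sym G c~r) w∈A r~w y∈A x~y
    ... | inj₁ y≡c = inj₁ y≡c
    ... | inj₂ y≡w = inj₂ (inj₂ y≡w)
    stay (inj₂ (inj₂ refl)) y∈A x~y with neighbour-of-two w∈A (Adj-irrefl G c~r) c∈A (Adj-sym G c~w) r∈A (Adj-sym G r~w) y∈A x~y
    ... | inj₁ y≡c = inj₁ y≡c
    ... | inj₂ y≡r = inj₂ (inj₁ y≡r)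
    reach : ∀ {x y} → OnTriangle x → WalkIn G A x y → OnTriangle y
    reach onT done = onT
    reach onT (edge x~y y∈A walk) = reach (stay onT y∈A x~y) walk
    closed : ∀ y → lookup A y ≡ true → c ≡ y ⊎ Adj G c y
    closed y y∈A with reach (inj₁ refl) (proj₁ unicyclic c y c∈A y∈A)
    ... | inj₁ refl = inj₁ refl
    ... | inj₂ (inj₁ refl) = inj₂ c~r
    ... | inj₂ (inj₂ refl) = inj₂ c~w

  -- If the robber could not leave N[c], then c would be adjacent to r and to r's other neighbour.
  escape : ∀ c r → lookup A c ≡ true → lookup A r ≡ true → c ≢ r →
           ∃ λ r′ → lookup A r′ ≡ true × Close G r r′ × r′ ≢ c × ¬ Adj G c r′
  escape c r c∈A r∈A c≢r
    with any? (λ r′ → (lookup A r′ ≟ᵇ true) ×-dec (((r ≟ᶠ r′) ⊎-dec (adj G r r′ ≟ᵇ true)) ×-dec (¬? (r′ ≟ᶠ c) ×-dec ¬? (adj G c r′ ≟ᵇ true))))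
  ... | yes witness = witness
  ... | no none = ⊥-elim (<⇒≱ 4≤∣A∣ (triangle⇒∣A∣≤3 c∈A r∈A w∈A c~r c~w r~w))
    where
    forced : ∀ r′ → lookup A r′ ≡ true → Close G r r′ → r′ ≢ c → Adj G c r′
    forced r′ r′∈A r≈r′ r′≢c with adj G c r′ in c~r′
    ... | true = refl
    ... | false = ⊥-elim (none (r′ , r′∈A , r≈r′ , r′≢c , λ c~r′′ → contradiction (trans (sym c~r′′) c~r′) λ ()))
    c~r : Adj G c r
    c~r = forced r r∈A (inj₁ refl) (c≢r ∘ sym)
    other : ∃ λ w → lookup A w ≡ true × Adj G r w × w ≢ c
    other = ∃neighbour≢ r∈A c∈A
    w : Fin n
    w = proj₁ other
    w∈A : lookup A w ≡ true
    w∈A = proj₁ (proj₂ other)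
    r~w : Adj G r w
    r~w = proj₁ (proj₂ (proj₂ other))
    c~w : Adj G c w
    c~w = forced w w∈A (inj₂ r~w) (proj₂ (proj₂ (proj₂ other)))

  ¬CopWin : ¬ CopWin G A
  ¬CopWin = robberEscapes⇒¬CopWin G A undominated escape

  Dart : Set
  Dart = ∃₂ λ x y → lookup A x ≡ true × lookup A y ≡ true × Adj G x y

  advance : Dart → Dart
  advance (x , y , x∈A , y∈A , x~y) = y , proj₁ next , y∈A , proj₁ (proj₂ next) , proj₁ (proj₂ (proj₂ next))
    where
    next : ∃ λ w → lookup A w ≡ true × Adj G y w × w ≢ x
    next = ∃neighbour≢ y∈A x∈A

  firstDart : Dart
  firstDart = z , proj₁ next , z∈A , proj₁ (proj₂ next) , proj₁ (proj₂ (proj₂ next))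
    where
    nonempty : ∃ λ z → 1 ≤ bool→ℕ (lookup A z)
    nonempty = ∑>0⇒∃>0 (bool→ℕ ∘ lookup A) (subst (1 ≤_) (∣S∣≡∑ A) (≤-trans (s≤s z≤n) 4≤∣A∣))
    z : Fin n
    z = proj₁ nonempty
    z∈A : lookup A z ≡ true
    z∈A = bool→ℕ≥1⇒true (proj₂ nonempty)
    next : ∃ λ w → lookup A w ≡ true × Adj G z w × w ≢ z
    next = ∃neighbour≢ z∈A z∈A

  dart : ℕ → Dart
  dart zero = firstDart
  dart (suc t) = advance (dart t)

  -- h 0, h 1, h 2, … walks around the cycle G[A] without turning back.
  h : ℕ → Fin n
  h t = proj₁ (dart t)

  h∈A : ∀ t → lookup A (h t) ≡ true
  h∈A t = proj₁ (proj₂ (proj₂ (dart t)))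

  h~h : ∀ t → Adj G (h t) (h (suc t))
  h~h t = proj₂ (proj₂ (proj₂ (proj₂ (dart t))))

  h-no-backtrack : ∀ t → h (suc (suc t)) ≢ h t
  h-no-backtrack t = proj₂ (proj₂ (proj₂ (∃neighbour≢ (h∈A (suc t)) (h∈A t))))

  neighbours-h : ∀ t {y} → lookup A y ≡ true → Adj G (h (suc t)) y → y ≡ h t ⊎ y ≡ h (suc (suc t))
  neighbours-h t y∈A h~y =
    neighbour-of-two (h∈A (suc t)) (h-no-backtrack t ∘ sym) (h∈A t) (Adj-sym G (h~h t)) (h∈A (suc (suc t))) (h~h (suc t)) y∈A h~y

  arc : ℕ → ℕ → Subset n
  arc s zero = ∅
  arc s (suc l) = arc s l [ h (s + l) ]≔ true

  ∈arc⁻ : ∀ s l {x} → lookup (arc s l) x ≡ true → ∃ λ e → e < l × h (s + e) ≡ x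
  ∈arc⁻ s zero {x} x∈arc with () ← trans (sym (lookup-replicate x false)) x∈arc
  ∈arc⁻ s (suc l) {x} x∈arc with x ≟ᶠ h (s + l)
  ... | yes refl = l , ≤-refl , refl
  ... | no x≢h with ∈arc⁻ s l (trans (sym (lookup∘update′ x≢h (arc s l) true)) x∈arc)
  ...   | e , e<l , h≡x = e , m<n⇒m<1+n e<l , h≡x

  ∈arc⁺ : ∀ s l {e} → e < l → lookup (arc s l) (h (s + e)) ≡ true
  ∈arc⁺ s (suc l) {e} e<1+l with e ≟ l
  ... | yes refl = lookup∘update (h (s + e)) (arc s e) true
  ... | no e≢l = ∈-[]≔true (arc s l) (h (s + l)) (∈arc⁺ s l (≤∧≢⇒< (s≤s⁻¹ e<1+l) e≢l))

  arc⊑A : ∀ s l → arc s l ⊑ A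
  arc⊑A s l x x∈arc with ∈arc⁻ s l x∈arc
  ... | e , _ , refl = h∈A (s + e)

  ∣arc∣≤ : ∀ s l → ∣ arc s l ∣ ≤ l
  ∣arc∣≤ s zero = ≤-reflexive (∣⊥∣≡0 n)
  ∣arc∣≤ s (suc l) = begin
    ∣ arc s (suc l) ∣                                        ≤⟨ m≤m+n _ _ ⟩
    ∣ arc s (suc l) ∣ + bool→ℕ (lookup (arc s l) (h (s + l))) ≡⟨ ∣[]≔∣ (arc s l) (h (s + l)) true ⟩
    ∣ arc s l ∣ + 1                                          ≤⟨ +-monoˡ-≤ 1 (∣arc∣≤ s l) ⟩
    l + 1                                                    ≡⟨ +-comm l 1 ⟩
    suc l                                                    ∎
    where open ≤-Reasoning

  InjectiveOn : ℕ → ℕ → Set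
  InjectiveOn s l = ∀ {e e′} → e < l → e′ < l → h (s + e) ≡ h (s + e′) → e ≡ e′

  ∣arc∣≡ : ∀ s l → InjectiveOn s l → ∣ arc s l ∣ ≡ l
  ∣arc∣≡ s zero _ = ∣⊥∣≡0 n
  ∣arc∣≡ s (suc l) injective = begin
    ∣ arc s (suc l) ∣                                        ≡⟨ +-identityʳ _ ⟨
    ∣ arc s (suc l) ∣ + 0                                    ≡⟨ cong (λ b → ∣ arc s (suc l) ∣ + bool→ℕ b) fresh ⟨
    ∣ arc s (suc l) ∣ + bool→ℕ (lookup (arc s l) (h (s + l))) ≡⟨ ∣[]≔∣ (arc s l) (h (s + l)) true ⟩
    ∣ arc s l ∣ + 1                                          ≡⟨ cong (_+ 1) (∣arc∣≡ s l (λ e< e′< → injective (m<n⇒m<1+n e<) (m<n⇒m<1+n e′<))) ⟩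
    l + 1                                                    ≡⟨ +-comm l 1 ⟩
    suc l                                                    ∎
    where
    open ≡-Reasoning
    fresh : lookup (arc s l) (h (s + l)) ≡ false
    fresh = ¬-not λ h∈arc → let e , e<l , h≡h = ∈arc⁻ s l h∈arc in
      <-irrefl (injective (m<n⇒m<1+n e<l) ≤-refl h≡h) e<l

  InjectiveOn-mono : ∀ {s l l′} → l ≤ l′ → InjectiveOn s l′ → InjectiveOn s l
  InjectiveOn-mono l≤l′ injective e< e′< = injective (<-≤-trans e< l≤l′) (<-≤-trans e′< l≤l′)

  InjectiveOn-extend : ∀ {s l} → InjectiveOn s l → (∀ {e} → e < l → h (s + l) ≢ h (s + e)) → InjectiveOn s (suc l)
  InjectiveOn-extend {s} {l} injective new {e} {e′} e<1+l e′<1+l eq with e ≟ l | e′ ≟ l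
  ... | yes refl | yes refl = refl
  ... | yes refl | no e′≢l = ⊥-elim (new (≤∧≢⇒< (s≤s⁻¹ e′<1+l) e′≢l) eq)
  ... | no e≢l | yes refl = ⊥-elim (new (≤∧≢⇒< (s≤s⁻¹ e<1+l) e≢l) (sym eq))
  ... | no e≢l | no e′≢l = injective (≤∧≢⇒< (s≤s⁻¹ e<1+l) e≢l) (≤∧≢⇒< (s≤s⁻¹ e′<1+l) e′≢l) eq

  first-return : ∀ {i j} → InjectiveOn 0 j → i < j → h j ≡ h i → i ≡ 0
  first-return {zero} _ _ _ = refl
  first-return {suc i} {suc j} injective (s≤s i<j) hj≡hi
    with neighbours-h i (h∈A j) (Adj-sym G (subst (Adj G (h j)) hj≡hi (h~h j)))
  ... | inj₁ hj≡h = ⊥-elim (<-irrefl (sym (injective (n<1+n j) (m<n⇒m<1+n i<j) hj≡h)) i<j)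
  ... | inj₂ hj≡h with suc (suc i) ≟ suc j
  ...   | yes 2+i≡1+j = ⊥-elim (Adj-irrefl G (h~h j) (trans hj≡h (cong h 2+i≡1+j)))
  ...   | no 2+i≢1+j = ⊥-elim (h-no-backtrack (suc i) (trans (cong (h ∘ suc) (sym j≡2+i)) hj≡hi))
    where
    j≡2+i : j ≡ suc (suc i)
    j≡2+i = injective (n<1+n j) (≤∧≢⇒< (s≤s i<j) 2+i≢1+j) hj≡h

  return⇒3≤ : ∀ j → h j ≡ h 0 → {{NonZero j}} → 3 ≤ j
  return⇒3≤ (suc zero) h1≡h0 = ⊥-elim (Adj-irrefl G (h~h 0) (sym h1≡h0))
  return⇒3≤ (suc (suc zero)) h2≡h0 = ⊥-elim (h-no-backtrack 0 h2≡h0)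
  return⇒3≤ (suc (suc (suc _))) _ = s≤s (s≤s (s≤s z≤n))

  -- After returning, the visited positions are closed under adjacency in G[A], hence cover A.
  return⇒A⊑arc : ∀ {j} → InjectiveOn 0 j → 1 ≤ j → h j ≡ h 0 → A ⊑ arc 0 j
  return⇒A⊑arc {suc j′} injective _ hj≡h0 y y∈A with reach (0 , s≤s z≤n , refl) (proj₁ unicyclic (h 0) y (h∈A 0) y∈A)
    where
    Visited : Fin n → Set
    Visited x = ∃ λ t → t < suc j′ × h t ≡ x
    2≤j′ : 2 ≤ j′
    2≤j′ = s≤s⁻¹ (return⇒3≤ (suc j′) hj≡h0)
    h0~hj′ : Adj G (h 0) (h j′)
    h0~hj′ = Adj-sym G (subst (Adj G (h j′)) hj≡h0 (h~h j′))
    h1≢hj′ : h 1 ≢ h j′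
    h1≢hj′ eq = <⇒≢ 2≤j′ (injective (s≤s (≤-trans (s≤s z≤n) 2≤j′)) (n<1+n j′) eq)
    stay : ∀ {x y} → Visited x → lookup A y ≡ true → Adj G x y → Visited y
    stay (zero , _ , refl) y∈A x~y with neighbour-of-two (h∈A 0) h1≢hj′ (h∈A 1) (h~h 0) (h∈A j′) h0~hj′ y∈A x~y
    ... | inj₁ refl = 1 , s≤s (≤-trans (s≤s z≤n) 2≤j′) , refl
    ... | inj₂ refl = j′ , n<1+n j′ , refl
    stay (suc t , t<j , refl) y∈A x~y with neighbours-h t y∈A x~y
    ... | inj₁ refl = t , <-trans (n<1+n t) t<j , refl
    ... | inj₂ refl with suc (suc t) ≟ suc j′
    ...   | yes 2+t≡j = 0 , s≤s z≤n , trans (sym hj≡h0) (cong h (sym 2+t≡j))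
    ...   | no 2+t≢j = suc (suc t) , ≤∧≢⇒< t<j 2+t≢j , refl
    reach : ∀ {x y} → Visited x → WalkIn G A x y → Visited y
    reach visited done = visited
    reach visited (edge x~y y∈A walk) = reach (stay visited y∈A x~y) walk
  ... | e , e<j , refl = ∈arc⁺ 0 (suc j′) e<j

  InjectiveOn⇒≤k : ∀ {j} → InjectiveOn 0 j → j ≤ k
  InjectiveOn⇒≤k {j} injective = subst (_≤ k) (∣arc∣≡ 0 j injective) (⊑⇒∣∣≤ {S = arc 0 j} {A} (arc⊑A 0 j))

  return⇒k≤ : ∀ {j} → InjectiveOn 0 j → 1 ≤ j → h j ≡ h 0 → k ≤ j
  return⇒k≤ {j} injective 1≤j hj≡h0 = ≤-trans (⊑⇒∣∣≤ {S = A} {arc 0 j} (return⇒A⊑arc injective 1≤j hj≡h0)) (∣arc∣≤ 0 j)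

  InjectiveOn-below-k : ∀ j → j ≤ k → InjectiveOn 0 j
  InjectiveOn-below-k zero _ ()
  InjectiveOn-below-k (suc j) 1+j≤k = InjectiveOn-extend {0} injective fresh
    where
    injective : InjectiveOn 0 j
    injective = InjectiveOn-below-k j (≤-trans (n≤1+n j) 1+j≤k)
    fresh : ∀ {i} → i < j → h j ≢ h i
    fresh i<j hj≡hi with first-return injective i<j hj≡hi
    ... | refl = <⇒≱ 1+j≤k (return⇒k≤ injective (≤-trans (s≤s z≤n) i<j) hj≡hi)

  h-period₀ : h k ≡ h 0
  h-period₀ with any? (λ (i : Fin k) → h k ≟ᶠ h (toℕ i))
  ... | yes (i , hk≡hi) = subst (λ t → h k ≡ h t) (first-return (InjectiveOn-below-k k ≤-refl) (toℕ<n i) hk≡hi) hk≡hi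
  ... | no none = ⊥-elim (<-irrefl refl (InjectiveOn⇒≤k (InjectiveOn-extend {0} (InjectiveOn-below-k k ≤-refl) fresh)))
    where
    fresh : ∀ {i} → i < k → h k ≢ h i
    fresh i<k hk≡hi = none (fromℕ< i<k , subst (λ t → h k ≡ h t) (sym (toℕ-fromℕ< i<k)) hk≡hi)

  0<k : 0 < k
  0<k = ≤-trans (s≤s z≤n) 4≤∣A∣

  InjectiveOn-k₀ : InjectiveOn 0 k
  InjectiveOn-k₀ = InjectiveOn-below-k k ≤-refl

  h-period₁ : h (suc k) ≡ h 1
  h-period₁ = go (pred k) (sym (suc-pred k {{>-nonZero 0<k}}))
    where
    go : ∀ k′ → k ≡ suc k′ → h (suc k) ≡ h 1
    go k′ k≡1+k′ with neighbours-h k′ (h∈A 1) (subst (λ x → Adj G x (h 1)) (trans (sym h-period₀) (cong h k≡1+k′)) (h~h 0))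
    ... | inj₂ h1≡h = trans (cong (h ∘ suc) k≡1+k′) (sym h1≡h)
    ... | inj₁ h1≡h with injective-at-1 ← InjectiveOn-k₀ (≤-trans (s≤s (s≤s z≤n)) 4≤∣A∣) (subst (k′ <_) (sym k≡1+k′) (n<1+n k′)) h1≡h
      = ⊥-elim (<⇒≱ 4≤∣A∣ (≤-trans (≤-reflexive (trans k≡1+k′ (cong suc (sym injective-at-1)))) (n≤1+n 2)))

  h-period : ∀ t → h (t + k) ≡ h t
  h-period t = proj₁ (both t)
    where
    both : ∀ t → h (t + k) ≡ h t × h (suc t + k) ≡ h (suc t)
    both zero = h-period₀ , h-period₁
    both (suc t) with both t
    ... | ht , h1+t = h1+t , forced
      where
      h1+t~ : Adj G (h (suc t)) (h (suc (suc t) + k))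
      h1+t~ = subst (λ x → Adj G x (h (suc (suc t) + k))) h1+t (h~h (suc t + k))
      forced : h (suc (suc t) + k) ≡ h (suc (suc t))
      forced with neighbours-h t (h∈A (suc (suc t) + k)) h1+t~
      ... | inj₂ eq = eq
      ... | inj₁ eq = ⊥-elim (h-no-backtrack (t + k) (trans eq (sym ht)))

  h-wrap : ∀ s e → suc e ≡ k → h (suc s + e) ≡ h (s + 0)
  h-wrap s e 1+e≡k = begin
    h (suc s + e)  ≡⟨ cong h (+-suc s e) ⟨
    h (s + suc e)  ≡⟨ cong (λ m → h (s + m)) 1+e≡k ⟩
    h (s + k)      ≡⟨ h-period s ⟩
    h s            ≡⟨ cong h (+-identityʳ s) ⟨
    h (s + 0)      ∎
    where open ≡-Reasoning

  -- Shifting the window by one, the index leaving it reappears at its start by periodicity.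
  InjectiveOn-k : ∀ s → InjectiveOn s k
  InjectiveOn-k zero = InjectiveOn-k₀
  InjectiveOn-k (suc s) {e} {e′} e<k e′<k eq with m≤n⇒m<n∨m≡n e<k | m≤n⇒m<n∨m≡n e′<k
  ... | inj₁ 1+e<k | inj₁ 1+e′<k =
    suc-injective (InjectiveOn-k s 1+e<k 1+e′<k (trans (cong h (+-suc s e)) (trans eq (cong h (sym (+-suc s e′))))))
  ... | inj₁ 1+e<k | inj₂ 1+e′≡k with () ← InjectiveOn-k s 1+e<k 0<k (trans (cong h (+-suc s e)) (trans eq (h-wrap s e′ 1+e′≡k)))
  ... | inj₂ 1+e≡k | inj₁ 1+e′<k with () ← InjectiveOn-k s 1+e′<k 0<k (trans (cong h (+-suc s e′)) (trans (sym eq) (h-wrap s e 1+e≡k)))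
  ... | inj₂ 1+e≡k | inj₂ 1+e′≡k = suc-injective (trans 1+e≡k (sym 1+e′≡k))

  arc-period : ∀ s l → arc (s + k) l ≡ arc s l
  arc-period s zero = refl
  arc-period s (suc l) = cong₂ (λ S x → S [ x ]≔ true) (arc-period s l) (trans (cong h shuffle) (h-period (s + l)))
    where
    shuffle : s + k + l ≡ s + l + k
    shuffle = trans (+-assoc s k l) (trans (cong (s +_) (+-comm k l)) (sym (+-assoc s l k)))

  h-onto : ∀ y → lookup A y ≡ true → ∃ λ t → t < k × h t ≡ y
  h-onto y y∈A = ∈arc⁻ 0 k (return⇒A⊑arc InjectiveOn-k₀ 0<k h-period₀ y y∈A)

  -- S is the maximal run of positions around t′ whose vertices lie in S, delimited by z.
  module ArcThrough {S : Subset n} (connected : ConnectedIn G S) (S⊑A : S ⊑ A)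
                    {z : Fin n} (z∈A : lookup A z ≡ true) (z∉S : lookup S z ≡ false)
                    {t : ℕ} (t<k : t < k) (ht∈S : lookup S (h t) ≡ true) where

    InS : ℕ → ℕ → Set
    InS a b = ∀ q → a ≤ q → q ≤ b → lookup S (h q) ≡ true

    InS-single : ∀ {p} → lookup S (h p) ≡ true → InS p p
    InS-single hp∈S q p≤q q≤p = subst (λ m → lookup S (h m) ≡ true) (≤-antisym p≤q q≤p) hp∈S

    InS-snoc : ∀ {a p} → InS a p → lookup S (h (suc p)) ≡ true → InS a (suc p)
    InS-snoc inS next∈S q a≤q q≤1+p with m≤n⇒m<n∨m≡n q≤1+p
    ... | inj₁ q<1+p = inS q a≤q (s≤s⁻¹ q<1+p)
    ... | inj₂ refl = next∈S

    InS-cons : ∀ {p b} → lookup S (h p) ≡ true → InS (suc p) b → InS p b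
    InS-cons {p} hp∈S inS q p≤q q≤b with m≤n⇒m<n∨m≡n p≤q
    ... | inj₁ p<q = inS q p<q q≤b
    ... | inj₂ refl = hp∈S

    run-start : ∀ p → lookup S (h p) ≡ true →
                ∃ λ a → a ≤ p × InS a p × (a ≡ 0 ⊎ ∃ λ a′ → a ≡ suc a′ × lookup S (h a′) ≡ false)
    run-start zero hp∈S = 0 , z≤n , InS-single hp∈S , inj₁ refl
    run-start (suc p) h1+p∈S with lookup S (h p) in hp∈S
    ... | false = suc p , ≤-refl , InS-single h1+p∈S , inj₂ (p , refl , hp∈S)
    ... | true with run-start p hp∈S
    ...   | a , a≤p , inS , boundary = a , m≤n⇒m≤1+n a≤p , InS-snoc inS h1+p∈S , boundary

    run-end : ∀ F p → lookup S (h p) ≡ true →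
              ∃ λ b → p ≤ b × InS p b × (lookup S (h (suc b)) ≡ false ⊎ b ≡ F + p)
    run-end zero p hp∈S = p , ≤-refl , InS-single hp∈S , inj₂ refl
    run-end (suc F) p hp∈S with lookup S (h (suc p)) in next∈S
    ... | false = p , ≤-refl , InS-single hp∈S , inj₁ next∈S
    ... | true with run-end F (suc p) next∈S
    ...   | b , 1+p≤b , inS , inj₁ end = b , ≤-trans (n≤1+n p) 1+p≤b , InS-cons hp∈S inS , inj₁ end
    ...   | b , 1+p≤b , inS , inj₂ b≡ = b , ≤-trans (n≤1+n p) 1+p≤b , InS-cons hp∈S inS , inj₂ (trans b≡ (+-suc F p))

    r : ℕ
    r = proj₁ (h-onto z z∈A)
    r<k : r < k
    r<k = proj₁ (proj₂ (h-onto z z∈A))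

    hr∉S : lookup S (h r) ≡ false
    hr∉S = trans (cong (lookup S) (proj₂ (proj₂ (h-onto z z∈A)))) z∉S

    -- h t also occurs at a position t′ in the window (r, r + k) of positions avoiding z.
    window : ∃ λ t′ → r < t′ × t′ < r + k × h t′ ≡ h t × (t′ ≡ t ⊎ t′ ≡ t + k)
    window with r <? t
    ... | yes r<t = t , r<t , ≤-trans t<k (m≤n+m k r) , refl , inj₁ refl
    ... | no r≮t = t + k , <-≤-trans r<k (m≤n+m k t) , +-monoˡ-< k (≤∧≢⇒< (≮⇒≥ r≮t) t≢r) , h-period t , inj₂ refl
      where
      t≢r : t ≢ r
      t≢r refl with () ← trans (sym ht∈S) hr∉S

    t′ : ℕ
    t′ = proj₁ window
    r<t′ : r < t′
    r<t′ = proj₁ (proj₂ window)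
    t′<r+k : t′ < r + k
    t′<r+k = proj₁ (proj₂ (proj₂ window))
    ht′∈S : lookup S (h t′) ≡ true
    ht′∈S = trans (cong (lookup S) (proj₁ (proj₂ (proj₂ (proj₂ window))))) ht∈S

    a : ℕ
    a = proj₁ (run-start t′ ht′∈S)
    a≤t′ : a ≤ t′
    a≤t′ = proj₁ (proj₂ (run-start t′ ht′∈S))

    r<a : r < a
    r<a with r <? a
    ... | yes r<a = r<a
    ... | no r≮a with () ← trans (sym (proj₁ (proj₂ (proj₂ (run-start t′ ht′∈S))) r (≮⇒≥ r≮a) (<⇒≤ r<t′))) hr∉S

    before-a : ∃ λ a′ → a ≡ suc a′ × lookup S (h a′) ≡ false
    before-a with proj₂ (proj₂ (proj₂ (run-start t′ ht′∈S)))
    ... | inj₂ boundary = boundary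
    ... | inj₁ a≡0 with () ← <-≤-trans r<a (≤-reflexive a≡0)

    b : ℕ
    b = proj₁ (run-end k t′ ht′∈S)
    t′≤b : t′ ≤ b
    t′≤b = proj₁ (proj₂ (run-end k t′ ht′∈S))

    InS-ab : InS a b
    InS-ab q a≤q q≤b with q <? t′
    ... | yes q<t′ = proj₁ (proj₂ (proj₂ (run-start t′ ht′∈S))) q a≤q (<⇒≤ q<t′)
    ... | no q≮t′ = proj₁ (proj₂ (proj₂ (run-end k t′ ht′∈S))) q (≮⇒≥ q≮t′) q≤b

    b<r+k : b < r + k
    b<r+k with b <? r + k
    ... | yes b<r+k = b<r+k
    ... | no b≮r+k with () ← trans (sym (InS-ab (r + k) (≤-trans a≤t′ (<⇒≤ t′<r+k)) (≮⇒≥ b≮r+k)))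
                                    (trans (cong (lookup S) (h-period r)) hr∉S)

    h1+b∉S : lookup S (h (suc b)) ≡ false
    h1+b∉S with proj₂ (proj₂ (proj₂ (run-end k t′ ht′∈S)))
    ... | inj₁ end = end
    ... | inj₂ b≡k+t′ = ⊥-elim (<⇒≱ b<r+k (≤-trans (≤-reflexive (+-comm r k)) (≤-trans (+-monoʳ-≤ k (<⇒≤ r<t′)) (≤-reflexive (sym b≡k+t′)))))

    just-before-a : ∀ {q} → a ≤ suc q → ¬ a ≤ q → lookup S (h q) ≡ false
    just-before-a {q} a≤1+q a≰q = subst (λ m → lookup S (h m) ≡ false) a′≡q (proj₂ (proj₂ before-a))
      where
      a′≡q : proj₁ before-a ≡ q
      a′≡q = suc-injective (trans (sym (proj₁ (proj₂ before-a))) (≤-antisym a≤1+q (≰⇒> a≰q)))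

    just-after-b : ∀ {q} → suc q ≤ b → ¬ suc (suc q) ≤ b → lookup S (h (suc (suc q))) ≡ false
    just-after-b 1+q≤b 2+q≰b = subst (λ m → lookup S (h (suc m)) ≡ false) (sym (≤-antisym 1+q≤b (s≤s⁻¹ (≰⇒> 2+q≰b)))) h1+b∉S

    Between : Fin n → Set
    Between x = ∃ λ q → a ≤ q × q ≤ b × h q ≡ x

    stay : ∀ {x y} → Between x → lookup S y ≡ true → Adj G x y → Between y
    stay (zero , a≤0 , _) _ _ = ⊥-elim (<⇒≱ (<-≤-trans r<a a≤0) z≤n)
    stay (suc q , a≤1+q , 1+q≤b , refl) y∈S x~y with neighbours-h q (S⊑A _ y∈S) x~y
    ... | inj₁ refl with a ≤? q
    ...   | yes a≤q = q , a≤q , ≤-trans (n≤1+n q) 1+q≤b , refl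
    ...   | no a≰q with () ← trans (sym y∈S) (just-before-a a≤1+q a≰q)
    stay (suc q , a≤1+q , 1+q≤b , refl) y∈S x~y | inj₂ refl with suc (suc q) ≤? b
    ... | yes 2+q≤b = suc (suc q) , ≤-trans a≤1+q (n≤1+n _) , 2+q≤b , refl
    ... | no 2+q≰b with () ← trans (sym y∈S) (just-after-b 1+q≤b 2+q≰b)

    reach : ∀ {x y} → Between x → WalkIn G S x y → Between y
    reach between done = between
    reach between (edge x~y y∈S walk) = reach (stay between y∈S x~y) walk

    ℓ : ℕ
    ℓ = suc (b ∸ a)

    S≡arc : S ≡ arc a ℓ
    S≡arc = ⊑-antisym S⊑arc arc⊑S
      where
      S⊑arc : S ⊑ arc a ℓ
      S⊑arc x x∈S with reach (t′ , a≤t′ , t′≤b , proj₁ (proj₂ (proj₂ (proj₂ window)))) (connected (h t) x ht∈S x∈S)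
      ... | q , a≤q , q≤b , refl = subst (λ m → lookup (arc a ℓ) (h m) ≡ true) (m+[n∸m]≡n a≤q) (∈arc⁺ a ℓ (s≤s (∸-monoˡ-≤ a q≤b)))
      arc⊑S : arc a ℓ ⊑ S
      arc⊑S x x∈arc with ∈arc⁻ a ℓ x∈arc
      ... | e , e<ℓ , refl = InS-ab (a + e) (m≤m+n a e) (subst (a + e ≤_) (m+[n∸m]≡n (≤-trans a≤t′ t′≤b)) (+-monoʳ-≤ a (s≤s⁻¹ e<ℓ)))

    ℓ≤k : ℓ ≤ k
    ℓ≤k = subst (b ∸ a <_) (m+n∸m≡n a k) (∸-monoˡ-< (<-≤-trans b<r+k (+-monoˡ-≤ k (<⇒≤ r<a))) (≤-trans a≤t′ t′≤b))

    ∣S∣≡ℓ : ∣ S ∣ ≡ ℓ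
    ∣S∣≡ℓ = trans (cong ∣_∣ S≡arc) (∣arc∣≡ a ℓ (InjectiveOn-mono {a} ℓ≤k (InjectiveOn-k a)))

    arc-through : ∃ λ d → d < ∣ S ∣ × S ≡ arc (t + k ∸ d) ∣ S ∣
    arc-through = d , subst (d <_) (sym ∣S∣≡ℓ) (s≤s (∸-monoˡ-≤ a t′≤b)) ,
                  trans S≡arc (trans (cong₂ arc a≡t′∸d (sym ∣S∣≡ℓ)) (normalise (proj₂ (proj₂ (proj₂ (proj₂ window))))))
      where
      d : ℕ
      d = t′ ∸ a
      a≡t′∸d : a ≡ t′ ∸ d
      a≡t′∸d = sym (m∸[m∸n]≡n a≤t′)
      normalise : t′ ≡ t ⊎ t′ ≡ t + k → arc (t′ ∸ d) ∣ S ∣ ≡ arc (t + k ∸ d) ∣ S ∣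
      normalise (inj₂ t′≡t+k) = cong (λ m → arc (m ∸ d) ∣ S ∣) t′≡t+k
      normalise (inj₁ t′≡t) = begin
        arc (t′ ∸ d) ∣ S ∣     ≡⟨ cong (λ m → arc (m ∸ d) ∣ S ∣) t′≡t ⟩
        arc (t ∸ d) ∣ S ∣      ≡⟨ arc-period (t ∸ d) ∣ S ∣ ⟨
        arc (t ∸ d + k) ∣ S ∣  ≡⟨ cong (λ s → arc s ∣ S ∣) (+-∸-comm k (subst (d ≤_) t′≡t (m∸n≤m t′ a))) ⟨
        arc (t + k ∸ d) ∣ S ∣  ∎
        where open ≡-Reasoning

  ¬CopWinSubset-large : ∀ {j S} → k ≤ j → ¬ CopWinSubset G A j S
  ¬CopWinSubset-large {j} {S} k≤j (S⊑A , refl , copWin) with ⊑⊎∃∈∖ A S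
  ... | inj₁ A⊑S = ¬CopWin (subst (CopWin G) (⊑-antisym S⊑A A⊑S) copWin)
  ... | inj₂ (z , z∈A , z∉S) = <⇒≱ ∣S∣<k k≤j
    where
    ∣S∣<k : ∣ S ∣ < k
    ∣S∣<k = subst (∣ S ∣ <_) (∣remove∣ A z z∈A) (s≤s (⊑⇒∣∣≤ {S = S} {remove A z} (⊑-remove {S = S} {A} z S⊑A z∉S)))

  -- The start t + k ∸ d of the arc, rather than t ∸ d, avoids truncated subtraction.
  arc-of : ∀ {j S} → CopWinSubset G A j S → j < k → ∀ {u} → lookup S u ≡ true →
           ∃ λ t → t < k × h t ≡ u × ∃ λ d → d < j × S ≡ arc (t + k ∸ d) j
  arc-of {j} {S} (S⊑A , refl , copWin) j<k {u} u∈S with h-onto u (S⊑A u u∈S) | ⊑⊎∃∈∖ A S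
  ... | _ | inj₁ A⊑S = ⊥-elim (<⇒≱ j<k (⊑⇒∣∣≤ {S = A} {S} A⊑S))
  ... | t , t<k , refl | inj₂ (z , z∈A , z∉S) =
    t , t<k , refl , ArcThrough.arc-through (CopWin⇒ConnectedIn G copWin) S⊑A z∈A z∉S t<k u∈S

  CopWinSubsets-length≤k : ∀ {j} L → Unique L → (∀ S → S ∈ L → CopWinSubset G A j S) → j < k → length L ≤ k
  CopWinSubsets-length≤k {j} L unique family j<k =
    subst (length L ≤_) (trans (length-map (λ s → arc s j) (upTo k)) (length-upTo k)) (Unique-⊆⇒length≤ unique arcs)
    where
    arcs : ∀ {S} → S ∈ L → S ∈ map (λ s → arc s j) (upTo k)
    arcs {S} S∈L with CopWin⇒nonempty G (proj₂ (proj₂ (family S S∈L)))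
    ... | u , u∈S with arc-of (family S S∈L) j<k u∈S
    ...   | t , t<k , _ , d , d<j , S≡arc with t + k ∸ d <? k
    ...     | yes s<k = subst (_∈ map (λ s → arc s j) (upTo k)) (sym S≡arc) (∈-map⁺ (λ s → arc s j) (∈-upTo⁺ s<k))
    ...     | no s≮k = subst (_∈ map (λ s → arc s j) (upTo k)) (sym (trans S≡arc reduce)) (∈-map⁺ (λ s → arc s j) (∈-upTo⁺ s∸k<k))
      where
      reduce : arc (t + k ∸ d) j ≡ arc (t + k ∸ d ∸ k) j
      reduce = trans (cong (λ s → arc s j) (sym (m∸n+n≡m (≮⇒≥ s≮k)))) (arc-period (t + k ∸ d ∸ k) j)
      s∸k<k : t + k ∸ d ∸ k < k
      s∸k<k = subst (t + k ∸ d ∸ k <_) (m+n∸n≡m k k) (∸-monoˡ-< (≤-<-trans (m∸n≤m (t + k) d) (+-monoˡ-< k t<k)) (≮⇒≥ s≮k))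

  CopWinSubsets∋-length≤j : ∀ {j u} L → lookup A u ≡ true → Unique L →
              (∀ S → S ∈ L → CopWinSubset G A j S × lookup S u ≡ true) → j < k → length L ≤ j
  CopWinSubsets∋-length≤j {j} {u} L u∈A unique family j<k =
    subst (length L ≤_) (trans (length-map arcAt (upTo j)) (length-upTo j)) (Unique-⊆⇒length≤ unique arcs)
    where
    t : ℕ
    t = proj₁ (h-onto u u∈A)
    arcAt : ℕ → Subset n
    arcAt d = arc (t + k ∸ d) j
    arcs : ∀ {S} → S ∈ L → S ∈ map arcAt (upTo j)
    arcs {S} S∈L with arc-of (proj₁ (family S S∈L)) j<k (proj₂ (family S S∈L))
    ... | t₂ , t₂<k , ht₂≡u , d , d<j , S≡arc =
      subst (_∈ map arcAt (upTo j)) (sym (trans S≡arc (cong (λ s → arc (s + k ∸ d) j) t₂≡t))) (∈-map⁺ arcAt (∈-upTo⁺ d<j))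
      where
      t₂≡t : t₂ ≡ t
      t₂≡t = InjectiveOn-k₀ t₂<k (proj₁ (proj₂ (h-onto u u∈A))) (trans ht₂≡u (sym (proj₂ (proj₂ (h-onto u u∈A)))))

-- The handshake lemma

sumˡ-tabulate : ∀ {n} (f : Fin n → ℕ) → sumˡ (tabulate f) ≡ ∑ f
sumˡ-tabulate {zero} f = refl
sumˡ-tabulate {suc n} f = cong (f zero +_) (sumˡ-tabulate (f ∘ suc))

sumˡ-allFin : ∀ {n} (f : Fin n → ℕ) → sumˡ (map f (allFin n)) ≡ ∑ f
sumˡ-allFin f = trans (cong sumˡ (map-tabulate id f)) (sumˡ-tabulate f)

<ᵇ≡false : ∀ {m n} → ¬ m < n → (m <ᵇ n) ≡ false
<ᵇ≡false {m} {n} m≮n with m <ᵇ n in eq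
... | true = contradiction (<ᵇ⇒< m n (subst T (sym eq) _)) m≮n
... | false = refl

<ᵇ≡true : ∀ {m n} → m < n → (m <ᵇ n) ≡ true
<ᵇ≡true {m} {n} m<n with m <ᵇ n | <⇒<ᵇ m<n
... | true | _ = refl

module _ {n : ℕ} (G : Graph n) where

  upper : Fin n → Fin n → ℕ
  upper i j = bool→ℕ (adj G i j ∧ (toℕ i <ᵇ toℕ j))

  adj≡upper+upper : ∀ i j → bool→ℕ (adj G i j) ≡ upper i j + upper j i
  adj≡upper+upper i j with <-cmp (toℕ i) (toℕ j)
  ... | tri< i<j _ j≮i rewrite <ᵇ≡true i<j | <ᵇ≡false j≮i | ∧-zeroʳ (adj G j i) | ∧-identityʳ (adj G i j) = sym (+-identityʳ _)
  ... | tri> i≮j _ j<i rewrite <ᵇ≡true j<i | <ᵇ≡false i≮j | ∧-zeroʳ (adj G i j) | ∧-identityʳ (adj G j i) = cong bool→ℕ (Graph.sym G i j)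
  ... | tri≈ _ i≡j _ rewrite toℕ-injective i≡j | Graph.irrefl G j = refl

  handshake : ∑ (λ i → ∑ (bool→ℕ ∘ adj G i)) ≡ 2 * edgeCount G
  handshake = begin
    ∑ (λ i → ∑ (bool→ℕ ∘ adj G i))                       ≡⟨ ∑-cong (λ i → trans (∑-cong (adj≡upper+upper i)) (∑-+ (upper i) (λ j → upper j i))) ⟩
    ∑ (λ i → ∑ (upper i) + ∑ (λ j → upper j i))          ≡⟨ ∑-+ (λ i → ∑ (upper i)) (λ i → ∑ (λ j → upper j i)) ⟩
    ∑ (λ i → ∑ (upper i)) + ∑ (λ i → ∑ (λ j → upper j i)) ≡⟨ cong (∑ (λ i → ∑ (upper i)) +_) (∑-comm (λ i j → upper j i)) ⟩
    ∑ (λ i → ∑ (upper i)) + ∑ (λ j → ∑ (upper j))        ≡⟨ cong₂ _+_ edges (trans edges (sym (+-identityʳ _))) ⟩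
    edgeCount G + (edgeCount G + 0)                      ∎
    where
    open ≡-Reasoning
    edges : ∑ (λ i → ∑ (upper i)) ≡ edgeCount G
    edges = sym (trans (cong sumˡ (map-cong (λ i → sumˡ-allFin (upper i)) (allFin n))) (sumˡ-allFin (λ i → ∑ (upper i))))

  Unicyclic⇒UnicyclicOn⊤ : Unicyclic G → UnicyclicOn G ⊤
  Unicyclic⇒UnicyclicOn⊤ (connected , edgeCount≡n) = connectedIn , degrees
    where
    ∈⊤ : ∀ x → lookup (⊤ {n}) x ≡ true
    ∈⊤ x = lookup-replicate x true
    walk : ∀ {x y} → Reach G x y → WalkIn G ⊤ x y
    walk here = done
    walk (step x~y reach) = edge x~y (∈⊤ _) (walk reach)
    connectedIn : ConnectedIn G ⊤
    connectedIn x y _ _ = walk (connected x y)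
    degIn⊤ : ∀ x → degIn G ⊤ x ≡ ∑ (bool→ℕ ∘ adj G x)
    degIn⊤ x rewrite ∈⊤ x = ∑-cong (λ y → cong (λ b → bool→ℕ (b ∧ adj G x y)) (∈⊤ y))
    degrees : ∑ (degIn G ⊤) ≡ 2 * ∣ ⊤ {n} ∣
    degrees = trans (∑-cong degIn⊤) (trans handshake (cong (2 *_) (trans edgeCount≡n (sym (∣⊤∣≡n n)))))

-- W_i(U_m): the i-sets through the centre, together with the m − 1 other singletons (i = 1) and the edge ab (i = 2)
W[U] : ℕ → ℕ → ℕ
W[U] m zero = 0
W[U] m (suc zero) = m
W[U] m (suc (suc zero)) = m
W[U] m (suc (suc (suc i))) = (m ∸ 1) C suc (suc i)

module CopWinSetsOfU (n₀ : ℕ) where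

  n₁ N : ℕ
  n₁ = 2 + n₀
  N = 1 + n₁

  centred : ℕ → List (Subset N)
  centred i = map (true ∷_) (subsetsOfSize ⊤ i)

  others : ℕ → List (Subset N)
  others zero = map (false ∷_) (subsetsOfSize ⊤ 1)
  others (suc zero) = (false ∷ true ∷ true ∷ ∅) ∷ []
  others (suc (suc _)) = []

  copWinSets : ℕ → List (Subset N)
  copWinSets zero = []
  copWinSets (suc i) = centred i ++ others i

  length-map-subsetsOfSize : ∀ b j → length (map (Data.Vec._∷_ b) (subsetsOfSize (⊤ {n₁}) j)) ≡ n₁ C j
  length-map-subsetsOfSize b j = trans (length-map _ (subsetsOfSize (⊤ {n₁}) j)) (trans (length-subsetsOfSize ⊤ j) (cong (_C j) (∣⊤∣≡n n₁)))

  length-copWinSets : ∀ i → length (copWinSets i) ≡ W[U] N i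
  length-copWinSets zero = refl
  length-copWinSets (suc zero) =
    trans (length-++ (centred 0)) (cong₂ _+_ (length-map-subsetsOfSize true 0) (trans (length-map-subsetsOfSize false 1) (nC1≡n n₁)))
  length-copWinSets (suc (suc zero)) =
    trans (length-++ (centred 1)) (trans (cong (_+ 1) (trans (length-map-subsetsOfSize true 1) (nC1≡n n₁))) (+-comm _ 1))
  length-copWinSets (suc (suc (suc i))) =
    trans (length-++ (centred (suc (suc i)))) (trans (+-identityʳ _) (length-map-subsetsOfSize true (suc (suc i))))

  copWinSets-unique : ∀ i → Unique (copWinSets i)
  copWinSets-unique zero = []
  copWinSets-unique (suc i) = ++⁺ (map⁺ ∷-injectiveʳ (subsetsOfSize-unique ⊤ i)) (others-unique i) disjoint
    where
    others-unique : ∀ i → Unique (others i)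
    others-unique zero = map⁺ ∷-injectiveʳ (subsetsOfSize-unique ⊤ 1)
    others-unique (suc zero) = [] ∷ []
    others-unique (suc (suc _)) = []
    centre∉others : ∀ i {S} → S ∈ others i → lookup S zero ≡ false
    centre∉others zero S∈ with _ , _ , refl ← ∈-map⁻ (false ∷_) S∈ = refl
    centre∉others (suc zero) (here refl) = refl
    disjoint : ∀ {S} → ¬ (S ∈ centred i × S ∈ others i)
    disjoint (S∈c , S∈o) with _ , _ , refl ← ∈-map⁻ (true ∷_) S∈c with () ← centre∉others i S∈o

  copWinSets-sound : ∀ i S → S ∈ copWinSets i → ∣ S ∣ ≡ i × CopWin (U N) S
  copWinSets-sound (suc i) S S∈ with ∈-++⁻ (centred i) S∈
  ... | inj₁ S∈c with T , T∈ , refl ← ∈-map⁻ (true ∷_) S∈c =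
    cong suc (proj₂ (subsetsOfSize-sound ⊤ i T T∈)) , dominating⇒CopWin (U N) (true ∷ T) zero refl centre-dominates
    where
    centre-dominates : ∀ r → lookup (true ∷ T) r ≡ true → r ≢ zero → Adj (U N) zero r
    centre-dominates zero _ r≢0 = ⊥-elim (r≢0 refl)
    centre-dominates (suc r) _ _ = refl
  copWinSets-sound (suc zero) S S∈ | inj₂ S∈o with T , T∈ , refl ← ∈-map⁻ (false ∷_) S∈o =
    ∣S∣≡1 , dominating⇒CopWin (U N) (false ∷ T) c c∈S (λ r r∈S r≢c → ⊥-elim (r≢c (∣∣≤1⇒≡ (false ∷ T) (≤-reflexive ∣S∣≡1) r∈S c∈S)))
    where
    ∣S∣≡1 : ∣ false ∷ T ∣ ≡ 1
    ∣S∣≡1 = proj₂ (subsetsOfSize-sound ⊤ 1 T T∈)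
    element : ∃ λ c → 1 ≤ bool→ℕ (lookup (false ∷ T) c)
    element = ∑>0⇒∃>0 (bool→ℕ ∘ lookup (false ∷ T)) (subst (1 ≤_) (∣S∣≡∑ (false ∷ T)) (≤-reflexive (sym ∣S∣≡1)))
    c : Fin N
    c = proj₁ element
    c∈S : lookup (false ∷ T) c ≡ true
    c∈S = bool→ℕ≥1⇒true (proj₂ element)
  copWinSets-sound (suc (suc zero)) S S∈ | inj₂ (here refl) =
    cong (2 +_) (∣⊥∣≡0 n₀) , dominating⇒CopWin (U N) (false ∷ true ∷ true ∷ ∅) (suc zero) refl a-dominates
    where
    a-dominates : ∀ r → lookup (false ∷ true ∷ true ∷ ∅) r ≡ true → r ≢ suc zero → Adj (U N) (suc zero) r
    a-dominates (suc zero) _ r≢a = ⊥-elim (r≢a refl)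
    a-dominates (suc (suc zero)) _ _ = refl
    a-dominates (suc (suc (suc r))) r∈S _ with () ← trans (sym r∈S) (lookup-replicate r false)

  W[U]≤ : ∀ i w → IsW (U N) i w → W[U] N i ≤ w
  W[U]≤ i w (L , _ , length≡w , exactly) = subst₂ _≤_ (length-copWinSets i) length≡w
    (Unique-⊆⇒length≤ (copWinSets-unique i) λ {S} S∈ → proj₂ (exactly S) (copWinSets-sound i S S∈))

W[U]≤W : ∀ n₀ i {w} → IsW (U (3 + n₀)) i w → W[U] (3 + n₀) i ≤ w
W[U]≤W n₀ i = CopWinSetsOfU.W[U]≤ n₀ i _

-- Unicyclic graphs with a leaf

C≤W[U] : ∀ m i → m ≤ 3 → m C suc i ≤ W[U] m (suc i)
C≤W[U] m zero _ = ≤-reflexive (nC1≡n m)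
C≤W[U] zero (suc i) _ = z≤n
C≤W[U] 1 (suc i) _ = z≤n
C≤W[U] 2 1 _ = s≤s z≤n
C≤W[U] 2 (suc (suc i)) _ = z≤n
C≤W[U] 3 1 _ = ≤-refl
C≤W[U] 3 2 _ = ≤-refl
C≤W[U] 3 (suc (suc (suc i))) _ = z≤n
C≤W[U] (suc (suc (suc (suc m)))) i (s≤s (s≤s (s≤s ())))

W[U]-leaf : ∀ m′ i → 1 ≤ m′ → (m′ ∸ 1) C (i ∸ 1) + W[U] m′ (suc i) ≡ W[U] (suc m′) (suc i)
W[U]-leaf m′ zero _ = refl
W[U]-leaf m′ 1 _ = refl
W[U]-leaf (suc m″) (suc (suc i)) _ = nCk+nC[k+1]≡[n+1]C[k+1] m″ (suc i)

-- b and a bound the cop-win sets through and avoiding a leaf whose removal leaves a cycle on m′ vertices.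
W[U]-cycle : ∀ {m′ i b a} → 4 ≤ m′ →
             (i ≡ 0 → b ≤ 1) → (1 ≤ i → i < m′ → b ≤ i) → (m′ ≤ i → b ≤ 0) →
             (suc i < m′ → a ≤ m′) → (m′ ≤ suc i → a ≤ 0) → b + a ≤ W[U] (suc m′) (suc i)
W[U]-cycle {m′} {i} 4≤m′ b≤1 b≤i b≤0 a≤m′ a≤0 with i
... | zero = +-mono-≤ (b≤1 refl) (a≤m′ (≤-trans (s≤s (s≤s z≤n)) 4≤m′))
... | suc zero = +-mono-≤ (b≤i ≤-refl (≤-trans (s≤s (s≤s z≤n)) 4≤m′)) (a≤m′ (≤-trans (s≤s (s≤s (s≤s z≤n))) 4≤m′))
... | suc (suc j) with suc (suc (suc j)) <? m′ | suc (suc j) <? m′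
...   | yes 3+j<m′ | _ = ≤-trans (+-mono-≤ (b≤i (s≤s z≤n) (<-trans (n<1+n _) 3+j<m′)) (a≤m′ 3+j<m′))
                                 (≤-trans (≤-reflexive (+-comm _ m′)) (m+k≤mCk (s≤s (s≤s z≤n)) (≤-trans (≤-reflexive (+-comm (suc (suc j)) 2)) 3+j<m′)))
...   | no 3+j≮m′ | yes 2+j<m′ = ≤-trans (+-mono-≤ (b≤i (s≤s z≤n) 2+j<m′) (a≤0 (≮⇒≥ 3+j≮m′)))
                                         (≤-trans (≤-reflexive (+-identityʳ _)) (≤-trans (<⇒≤ 2+j<m′) (m≤mCk (s≤s z≤n) 2+j<m′)))
...   | no 3+j≮m′ | no 2+j≮m′ = ≤-trans (+-mono-≤ (b≤0 (≮⇒≥ 2+j≮m′)) (a≤0 (≮⇒≥ 3+j≮m′))) z≤n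

module _ {n : ℕ} (G : Graph n) where

  CopWin∋leaf⇒∋neighbour : ∀ {A S l u} → S ⊑ A → CopWin G S → lookup S l ≡ true → 2 ≤ ∣ S ∣ →
                           (∀ v → lookup A v ≡ true → Adj G l v → v ≡ u) → lookup S u ≡ true
  CopWin∋leaf⇒∋neighbour {S = S} {l} S⊑A copWin l∈S 2≤∣S∣ only-u with ∃∈≢ S l 2≤∣S∣
  ... | x , x∈S , x≢l with CopWin⇒ConnectedIn G copWin l x l∈S x∈S
  ...   | done = ⊥-elim (x≢l refl)
  ...   | edge l~y y∈S _ = subst (λ v → lookup S v ≡ true) (only-u _ (S⊑A _ y∈S) l~y) y∈S

  module LeafStep {A : Subset n} {l : Fin n} (unicyclic : UnicyclicOn G A) (leaf : IsLeaf G A l)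
                  {i : ℕ} {L : List (Subset n)} (unique : Unique L)
                  (family : ∀ S → S ∈ L → CopWinSubset G A (suc i) S) where

    open LeafRemoval G unicyclic leaf public

    A′ : Subset n
    A′ = remove A l

    ∋l? : (S : Subset n) → Dec (lookup S l ≡ true)
    ∋l? S = lookup S l ≟ᵇ true

    L₁ L₀ : List (Subset n)
    L₁ = filter ∋l? L
    L₀ = filter (¬? ∘ ∋l?) L

    length-L : length L ≡ length L₁ + length L₀
    length-L = length-filter-split ∋l? L

    L₁-family : ∀ {S} → S ∈ L₁ → CopWinSubset G A (suc i) S × lookup S l ≡ true
    L₁-family {S} S∈ with S∈L , l∈S ← ∈-filter⁻ ∋l? {xs = L} S∈ = family S S∈L , l∈S

    L₀-family : ∀ S → S ∈ L₀ → CopWinSubset G A′ (suc i) S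
    L₀-family S S∈ with S∈L , l∉S ← ∈-filter⁻ (¬? ∘ ∋l?) {xs = L} S∈ with family S S∈L
    ... | S⊑A , ∣S∣≡ , copWin = ⊑-remove {S = S} {A} l S⊑A (¬-not l∉S) , ∣S∣≡ , copWin

    L₁-∋u : 1 ≤ i → ∀ {S} → S ∈ L₁ → lookup S u ≡ true
    L₁-∋u 1≤i S∈ with (S⊑A , ∣S∣≡ , copWin) , l∈S ← L₁-family S∈ =
      CopWin∋leaf⇒∋neighbour {A = A} S⊑A copWin l∈S (subst (2 ≤_) (sym ∣S∣≡) (s≤s 1≤i)) (λ v v∈A l~v → neighbour-unique v∈A l~v)

    remove-l-injective : ∀ {S T} → S ∈ L₁ → T ∈ L₁ → remove S l ≡ remove T l → S ≡ T
    remove-l-injective S∈ T∈ = remove-injective l (proj₂ (L₁-family S∈)) (proj₂ (L₁-family T∈))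

    length-L₁-singletons : i ≡ 0 → length L₁ ≤ 1
    length-L₁-singletons refl = subst (_≤ 1) (length-map (λ S → remove S l) L₁)
                  (length≤C A′ 0 (map (λ S → remove S l) L₁) (map⁺-injectiveOn _ remove-l-injective (filter⁺ ∋l? unique)) singletons)
      where
      singletons : ∀ S′ → S′ ∈ map (λ S → remove S l) L₁ → S′ ⊑ A′ × ∣ S′ ∣ ≡ 0
      singletons S′ S′∈ with S , S∈ , refl ← ∈-map⁻ (λ S → remove S l) S′∈ with L₁-family S∈
      ... | (S⊑A , ∣S∣≡1 , _) , l∈S = remove-mono {S = S} {A} l S⊑A , suc-injective (trans (∣remove∣ S l l∈S) ∣S∣≡1)
    length-L₁-through-u : ∀ {i′} → i ≡ suc i′ → length L₁ ≤ (∣ A′ ∣ ∸ 1) C i′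
    length-L₁-through-u {i′} refl = subst (_≤ (∣ A′ ∣ ∸ 1) C i′) (length-map strip L₁)
                    (subst (λ m → length (map strip L₁) ≤ m C i′) ∣A′-u∣
                      (length≤C (remove A′ u) i′ (map strip L₁) (map⁺-injectiveOn strip strip-injective (filter⁺ ∋l? unique)) stripped))
      where
      strip : Subset n → Subset n
      strip S = remove (remove S l) u
      u∈S-l : ∀ {S} → S ∈ L₁ → lookup (remove S l) u ≡ true
      u∈S-l {S} S∈ = ∈-remove⁺ S u≢l (L₁-∋u (s≤s z≤n) S∈)
      strip-injective : ∀ {S T} → S ∈ L₁ → T ∈ L₁ → strip S ≡ strip T → S ≡ T
      strip-injective S∈ T∈ = remove-l-injective S∈ T∈ ∘ remove-injective u (u∈S-l S∈) (u∈S-l T∈)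
      ∣A′-u∣ : ∣ remove A′ u ∣ ≡ ∣ A′ ∣ ∸ 1
      ∣A′-u∣ = cong (_∸ 1) (∣remove∣ A′ u u∈A-l)
      stripped : ∀ S′ → S′ ∈ map strip L₁ → S′ ⊑ remove A′ u × ∣ S′ ∣ ≡ i′
      stripped S′ S′∈ with S , S∈ , refl ← ∈-map⁻ strip S′∈ with L₁-family S∈
      ... | (S⊑A , ∣S∣≡ , _) , l∈S =
        remove-mono {S = remove S l} {A′} u (remove-mono {S = S} {A} l S⊑A) ,
        suc-injective (suc-injective (trans (cong suc (∣remove∣ (remove S l) u (u∈S-l S∈))) (trans (∣remove∣ S l l∈S) ∣S∣≡)))

    length-L₁ : length L₁ ≤ (∣ A′ ∣ ∸ 1) C (i ∸ 1)
    length-L₁ = byCases i refl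
      where
      byCases : ∀ i₀ → i ≡ i₀ → length L₁ ≤ (∣ A′ ∣ ∸ 1) C (i₀ ∸ 1)
      byCases zero i≡0 = length-L₁-singletons i≡0
      byCases (suc i′) i≡1+i′ = length-L₁-through-u i≡1+i′

    module WhenCycle (leafless′ : ¬ HasLeaf G A′) (4≤∣A′∣ : 4 ≤ ∣ A′ ∣) where

      open LeaflessUnicyclic G UnicyclicOn-remove leafless′ 4≤∣A′∣ using (CopWinSubsets-length≤k; CopWinSubsets∋-length≤j; ¬CopWinSubset-large)

      length-L₀-small : suc i < ∣ A′ ∣ → length L₀ ≤ ∣ A′ ∣
      length-L₀-small = CopWinSubsets-length≤k L₀ (filter⁺ (¬? ∘ ∋l?) unique) L₀-family

      length-L₀-large : ∣ A′ ∣ ≤ suc i → length L₀ ≤ 0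
      length-L₀-large large = Unique-⊆⇒length≤ {ys = []} (filter⁺ (¬? ∘ ∋l?) unique) λ {S} S∈ → ⊥-elim (¬CopWinSubset-large large (L₀-family S S∈))

      L₁′ : List (Subset n)
      L₁′ = map (λ S → remove S l) L₁

      L₁′-unique : Unique L₁′
      L₁′-unique = map⁺-injectiveOn _ remove-l-injective (filter⁺ ∋l? unique)

      L₁′-family : 1 ≤ i → ∀ S′ → S′ ∈ L₁′ → CopWinSubset G A′ i S′ × lookup S′ u ≡ true
      L₁′-family 1≤i S′ S′∈ with S , S∈ , refl ← ∈-map⁻ (λ S → remove S l) S′∈ with L₁-family S∈
      ... | (S⊑A , ∣S∣≡ , copWin) , l∈S =
        (remove-mono {S = S} {A} l S⊑A , suc-injective (trans (∣remove∣ S l l∈S) ∣S∣≡) ,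
         CopWin-remove-pendant G (L₁-∋u 1≤i S∈) u≢l (λ v v∈S l~v → neighbour-unique (S⊑A v v∈S) l~v) copWin) ,
        ∈-remove⁺ S u≢l (L₁-∋u 1≤i S∈)

      length-L₁-small : 1 ≤ i → i < ∣ A′ ∣ → length L₁ ≤ i
      length-L₁-small 1≤i = subst (_≤ i) (length-map _ L₁) ∘ CopWinSubsets∋-length≤j L₁′ u∈A-l L₁′-unique (L₁′-family 1≤i)

      length-L₁-large : 1 ≤ i → ∣ A′ ∣ ≤ i → length L₁ ≤ 0
      length-L₁-large 1≤i large = subst (_≤ 0) (length-map _ L₁)
        (Unique-⊆⇒length≤ {ys = []} L₁′-unique λ {S′} S′∈ → ⊥-elim (¬CopWinSubset-large large (proj₁ (L₁′-family 1≤i S′ S′∈))))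

  W≤W[U]-small : ∀ m A → ∣ A ∣ ≡ m → m ≤ 3 → ∀ i {L} → Unique L → (∀ S → S ∈ L → CopWinSubset G A (suc i) S) →
                 length L ≤ W[U] m (suc i)
  W≤W[U]-small m A ∣A∣≡m m≤3 i {L} unique family =
    ≤-trans (length≤C A (suc i) L unique (λ S S∈ → proj₁ (family S S∈) , proj₁ (proj₂ (family S S∈))))
            (subst (λ m′ → m′ C suc i ≤ W[U] m (suc i)) (sym ∣A∣≡m) (C≤W[U] m i m≤3))

  W≤W[U] : ∀ m {A} → ∣ A ∣ ≡ m → UnicyclicOn G A → HasLeaf G A ⊎ m ≤ 3 →
           ∀ i {L} → Unique L → (∀ S → S ∈ L → CopWinSubset G A i S) → length L ≤ W[U] m i
  W≤W[U] m {A} _ _ _ zero unique family = Unique-⊆⇒length≤ {ys = []} unique λ {S} S∈ → ⊥-elim (¬CopWinSubset-0 G {A} (family S S∈))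
  W≤W[U] zero {A} ∣A∣≡0 _ _ (suc i) unique family = W≤W[U]-small zero A ∣A∣≡0 z≤n i unique family
  W≤W[U] (suc m′) {A} ∣A∣≡1+m′ unicyclic leafy (suc i) {L} unique family with suc m′ ≤? 3 | leafy
  ... | yes m≤3 | _ = W≤W[U]-small (suc m′) A ∣A∣≡1+m′ m≤3 i unique family
  ... | no m≰3 | inj₂ m≤3 = ⊥-elim (m≰3 m≤3)
  ... | no m≰3 | inj₁ (l , leaf) = subst (_≤ W[U] (suc m′) (suc i)) (sym length-L) bound
    where
    open LeafStep unicyclic leaf unique family
    ∣A′∣≡m′ : ∣ A′ ∣ ≡ m′
    ∣A′∣≡m′ = suc-injective (trans ∣A-l∣ ∣A∣≡1+m′)
    viaInduction : HasLeaf G A′ ⊎ m′ ≤ 3 → length L₁ + length L₀ ≤ W[U] (suc m′) (suc i)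
    viaInduction leafy′ = subst (length L₁ + length L₀ ≤_) (W[U]-leaf m′ i (≤-trans (s≤s z≤n) (s≤s⁻¹ (≰⇒> m≰3))))
      (+-mono-≤ (subst (λ m → length L₁ ≤ (m ∸ 1) C (i ∸ 1)) ∣A′∣≡m′ length-L₁)
                (W≤W[U] m′ ∣A′∣≡m′ UnicyclicOn-remove leafy′ (suc i) (filter⁺ (¬? ∘ ∋l?) unique) L₀-family))
    bound : length L₁ + length L₀ ≤ W[U] (suc m′) (suc i)
    bound with hasLeaf? G A′ | m′ ≤? 3
    ... | yes leafy′ | _ = viaInduction (inj₁ leafy′)
    ... | no _ | yes m′≤3 = viaInduction (inj₂ m′≤3)
    ... | no leafless′ | no m′≰3 =
      W[U]-cycle 4≤m′ length-L₁-singletons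
                 (λ 1≤i i<m′ → length-L₁-small 1≤i (subst (i <_) (sym ∣A′∣≡m′) i<m′))
                 (λ m′≤i → length-L₁-large (≤-trans (s≤s z≤n) (≤-trans 4≤m′ m′≤i)) (subst (_≤ i) (sym ∣A′∣≡m′) m′≤i))
                 (λ 1+i<m′ → subst (length L₀ ≤_) ∣A′∣≡m′ (length-L₀-small (subst (suc i <_) (sym ∣A′∣≡m′) 1+i<m′)))
                 (λ m′≤1+i → length-L₀-large (subst (_≤ suc i) (sym ∣A′∣≡m′) m′≤1+i))
      where
      4≤m′ : 4 ≤ m′
      4≤m′ = ≰⇒> m′≰3
      open WhenCycle leafless′ (subst (4 ≤_) (sym ∣A′∣≡m′) 4≤m′)

-- Node cop-win reliability polynomials

ℕtoℚ≡mkℚ : ∀ a → ℕtoℚ a ≡ mkℚ (ℤ.+ a) 0 (coprime-sym (1-coprimeTo a))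
ℕtoℚ≡mkℚ a = ℚ.normalize-coprime (coprime-sym (1-coprimeTo a))

ℕtoℚ-suc : ∀ a → ℕtoℚ (suc a) ≡ ℕtoℚ a +ℚ 1ℚ
ℕtoℚ-suc a = ℚ.toℚᵘ-injective (ℚᵘ.≃-trans unnormalised (ℚᵘ.≃-sym (ℚ.toℚᵘ-homo-+ (ℕtoℚ a) 1ℚ)))
  where
  unnormalised : toℚᵘ (ℕtoℚ (suc a)) ℚᵘ.≃ (toℚᵘ (ℕtoℚ a) ℚᵘ.+ toℚᵘ 1ℚ)
  unnormalised rewrite ℕtoℚ≡mkℚ (suc a) | ℕtoℚ≡mkℚ a =
    ℚᵘ.*≡* (trans (ℤ.*-identityʳ (ℤ.+ suc a)) (sym (trans (ℤ.*-identityʳ _) (trans (cong₂ ℤ._+_ (ℤ.*-identityʳ (ℤ.+ a)) refl) (cong ℤ.+_ (+-comm a 1))))))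

ℕtoℚ-mono-≤ : ∀ {a b} → a ≤ b → ℕtoℚ a ≤ℚ ℕtoℚ b
ℕtoℚ-mono-≤ {a} {b} a≤b rewrite ℕtoℚ≡mkℚ a | ℕtoℚ≡mkℚ b =
  *≤* (subst₂ ℤ._≤_ (sym (ℤ.*-identityʳ (ℤ.+ a))) (sym (ℤ.*-identityʳ (ℤ.+ b))) (ℤ.+≤+ a≤b))

0≤* : ∀ {a b} → 0ℚ ≤ℚ a → 0ℚ ≤ℚ b → 0ℚ ≤ℚ a *ℚ b
0≤* {a} {b} 0≤a 0≤b = ℚ.nonNegative⁻¹ (a *ℚ b) {{ℚ.nonNeg*nonNeg⇒nonNeg a {{nonNegative 0≤a}} b {{nonNegative 0≤b}}}}

0≤^ : ∀ {x} k → 0ℚ ≤ℚ x → 0ℚ ≤ℚ x ^ℚ k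
0≤^ zero _ = *≤* (ℤ.+≤+ z≤n)
0≤^ (suc k) 0≤x = 0≤* 0≤x (0≤^ k 0≤x)

0≤square : ∀ r → 0ℚ ≤ℚ r *ℚ r
0≤square r with ℚ.≤-total r 0ℚ
... | inj₁ r≤0 = ℚ.nonNegative⁻¹ (r *ℚ r) {{ℚ.nonPos*nonPos⇒nonPos r {{nonPositive r≤0}} r {{nonPositive r≤0}}}}
... | inj₂ 0≤r = 0≤* 0≤r 0≤r

0≤- : ∀ {x y} → x ≤ℚ y → 0ℚ ≤ℚ y -ℚ x
0≤- {x} {y} x≤y = subst (_≤ℚ y -ℚ x) (ℚ.+-inverseʳ x) (ℚ.+-monoˡ-≤ (-ℚ x) x≤y)

≤-via-difference : ∀ {a b d} → 0ℚ ≤ℚ d → a +ℚ d ≡ b → a ≤ℚ b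
≤-via-difference {a} {b} {d} 0≤d a+d≡b = subst₂ _≤ℚ_ (ℚ.+-identityʳ a) a+d≡b (ℚ.+-monoʳ-≤ a 0≤d)

ℕtoℚ-*-mono-≤ : ∀ {a b} X → a ≤ b → 0ℚ ≤ℚ X → ℕtoℚ a *ℚ X ≤ℚ ℕtoℚ b *ℚ X
ℕtoℚ-*-mono-≤ X a≤b 0≤X = ℚ.*-monoʳ-≤-nonNeg X {{nonNegative 0≤X}} (ℕtoℚ-mono-≤ a≤b)

sumFrom1-mono-≤ : ∀ m {f g : ℕ → ℚ} → (∀ i → 1 ≤ i → i ≤ m → f i ≤ℚ g i) → sumFrom1 m f ≤ℚ sumFrom1 m g
sumFrom1-mono-≤ zero _ = ℚ.≤-refl
sumFrom1-mono-≤ (suc m) f≤g =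
  ℚ.+-mono-≤ (sumFrom1-mono-≤ m (λ i 1≤i i≤m → f≤g i 1≤i (≤-trans i≤m (n≤1+n m)))) (f≤g (suc m) (s≤s z≤n) ≤-refl)

-- q p ≤ q² + p², because the difference is (q − p)² + q p.
middle-weight≤outer-weights : ∀ {q p} k → 0ℚ ≤ℚ q → 0ℚ ≤ℚ p →
  (q ^ℚ 1) *ℚ (p ^ℚ suc (suc k)) ≤ℚ (q ^ℚ 2) *ℚ (p ^ℚ suc k) +ℚ (q ^ℚ 0) *ℚ (p ^ℚ suc (suc (suc k)))
middle-weight≤outer-weights {q} {p} k 0≤q 0≤p =
  ≤-via-difference (0≤* (0≤^ (suc k) 0≤p) (ℚ.+-mono-≤ (0≤square (q -ℚ p)) (0≤* 0≤q 0≤p))) identity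
  where
  open +-*-Solver
  P : ℚ
  P = p ^ℚ suc k
  identity : (q *ℚ 1ℚ) *ℚ (p *ℚ P) +ℚ P *ℚ ((q -ℚ p) *ℚ (q -ℚ p) +ℚ q *ℚ p) ≡ (q *ℚ (q *ℚ 1ℚ)) *ℚ P +ℚ 1ℚ *ℚ (p *ℚ (p *ℚ P))
  identity = solve 3 (λ q p P → (q :* con 1ℚ) :* (p :* P) :+ P :* ((q :- p) :* (q :- p) :+ q :* p) :=
                                (q :* (q :* con 1ℚ)) :* P :+ con 1ℚ :* (p :* (p :* P))) refl q p P

-- One unit of weight moves from the middle coefficient to each of the outer ones.
tail-exchange : ∀ c {S S′ X Y Z : ℚ} {a₁ a₂ a₃ b₁ b₂ b₃ : ℕ} → S ≤ℚ S′ →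
  0ℚ ≤ℚ X → 0ℚ ≤ℚ Y → 0ℚ ≤ℚ Z → Y ≤ℚ X +ℚ Z →
  a₁ ≤ suc c → a₂ ≤ suc c → a₃ ≤ 0 → suc (suc c) ≤ b₁ → c ≤ b₂ → 1 ≤ b₃ →
  S +ℚ ℕtoℚ a₁ *ℚ X +ℚ ℕtoℚ a₂ *ℚ Y +ℚ ℕtoℚ a₃ *ℚ Z ≤ℚ S′ +ℚ ℕtoℚ b₁ *ℚ X +ℚ ℕtoℚ b₂ *ℚ Y +ℚ ℕtoℚ b₃ *ℚ Z
tail-exchange c {S} {S′} {X} {Y} {Z} {a₁} {a₂} {a₃} {b₁} {b₂} {b₃} S≤S′ 0≤X 0≤Y 0≤Z Y≤X+Z a₁≤ a₂≤ a₃≤ ≤b₁ ≤b₂ ≤b₃ = begin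
  S +ℚ ℕtoℚ a₁ *ℚ X +ℚ ℕtoℚ a₂ *ℚ Y +ℚ ℕtoℚ a₃ *ℚ Z
    ≤⟨ ℚ.+-mono-≤ (ℚ.+-mono-≤ (ℚ.+-mono-≤ S≤S′ (ℕtoℚ-*-mono-≤ X a₁≤ 0≤X)) (ℕtoℚ-*-mono-≤ Y a₂≤ 0≤Y)) (ℕtoℚ-*-mono-≤ Z a₃≤ 0≤Z) ⟩
  S′ +ℚ ℕtoℚ (suc c) *ℚ X +ℚ ℕtoℚ (suc c) *ℚ Y +ℚ ℕtoℚ 0 *ℚ Z
    ≤⟨ exchange ⟩
  S′ +ℚ ℕtoℚ (suc (suc c)) *ℚ X +ℚ ℕtoℚ c *ℚ Y +ℚ ℕtoℚ 1 *ℚ Z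
    ≤⟨ ℚ.+-mono-≤ (ℚ.+-mono-≤ (ℚ.+-monoʳ-≤ S′ (ℕtoℚ-*-mono-≤ X ≤b₁ 0≤X)) (ℕtoℚ-*-mono-≤ Y ≤b₂ 0≤Y)) (ℕtoℚ-*-mono-≤ Z ≤b₃ 0≤Z) ⟩
  S′ +ℚ ℕtoℚ b₁ *ℚ X +ℚ ℕtoℚ b₂ *ℚ Y +ℚ ℕtoℚ b₃ *ℚ Z ∎
  where
  open ℚ.≤-Reasoning
  open +-*-Solver
  exchange : S′ +ℚ ℕtoℚ (suc c) *ℚ X +ℚ ℕtoℚ (suc c) *ℚ Y +ℚ ℕtoℚ 0 *ℚ Z ≤ℚ S′ +ℚ ℕtoℚ (suc (suc c)) *ℚ X +ℚ ℕtoℚ c *ℚ Y +ℚ ℕtoℚ 1 *ℚ Z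
  exchange rewrite ℕtoℚ-suc (suc c) | ℕtoℚ-suc c | ℕtoℚ-suc 0 = ≤-via-difference (0≤- Y≤X+Z)
    (solve 5 (λ S′ c X Y Z → S′ :+ (c :+ con 1ℚ) :* X :+ (c :+ con 1ℚ) :* Y :+ con 0ℚ :* Z :+ ((X :+ Z) :- Y) :=
                             S′ :+ ((c :+ con 1ℚ) :+ con 1ℚ) :* X :+ c :* Y :+ (con 0ℚ :+ con 1ℚ) :* Z) refl S′ (ℕtoℚ c) X Y Z)

module _ (n : ℕ) {p : ℚ} (0≤p : 0ℚ ≤ℚ p) (p≤1 : p ≤ℚ 1ℚ) where

  weight : ℕ → ℚ
  weight i = ((1ℚ -ℚ p) ^ℚ (n ∸ i)) *ℚ (p ^ℚ i)

  0≤weight : ∀ i → 0ℚ ≤ℚ weight i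
  0≤weight i = 0≤* (0≤^ (n ∸ i) (0≤- p≤1)) (0≤^ i 0≤p)

  NCRelPoly-mono : ∀ {V W} → (∀ i → 1 ≤ i → i ≤ n → V i ≤ W i) → NCRelPoly n V p ≤ℚ NCRelPoly n W p
  NCRelPoly-mono V≤W = sumFrom1-mono-≤ n (λ i 1≤i i≤n → ℕtoℚ-*-mono-≤ (weight i) (V≤W i 1≤i i≤n) (0≤weight i))

-- Only the coefficient of p^{n-1} q can favour the cycle, and it is paid for by those of p^{n-2} q² and p^n.
NCRelPoly-cycle≤ : ∀ n₄ {V W p} → 0ℚ ≤ℚ p → p ≤ℚ 1ℚ →
  (∀ i → i < 5 + n₄ → V i ≤ 5 + n₄) → V (5 + n₄) ≤ 0 → (∀ i → W[U] (5 + n₄) i ≤ W i) →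
  NCRelPoly (5 + n₄) V p ≤ℚ NCRelPoly (5 + n₄) W p
NCRelPoly-cycle≤ n₄ {V} {W} {p} 0≤p p≤1 V< Vn W≥ =
  tail-exchange (4 + n₄) head (0≤x (3 + n₄)) (0≤x (4 + n₄)) (0≤x n) middle
    (V< (3 + n₄) (n≤1+n _)) (V< (4 + n₄) ≤-refl) Vn
    (≤-trans 1+n≤W[U] (W≥ (3 + n₄))) (≤-trans (m≤mCk (s≤s z≤n) ≤-refl) (W≥ (4 + n₄))) (≤-trans (1≤C {4 + n₄} ≤-refl) (W≥ n))
  where
  n : ℕ
  n = 5 + n₄
  x : ℕ → ℚ
  x = weight n 0≤p p≤1
  0≤x : ∀ i → 0ℚ ≤ℚ x i
  0≤x = 0≤weight n 0≤p p≤1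
  term : (ℕ → ℕ) → ℕ → ℚ
  term U i = ℕtoℚ (U i) *ℚ x i
  n≤W[U] : ∀ i → 1 ≤ i → i ≤ 2 + n₄ → n ≤ W[U] n i
  n≤W[U] 1 _ _ = ≤-refl
  n≤W[U] 2 _ _ = ≤-refl
  n≤W[U] (suc (suc (suc j))) _ (s≤s (s≤s 1+j≤n₄)) = begin
    n                     ≡⟨ +-comm 1 (4 + n₄) ⟩
    4 + n₄ + 1            ≤⟨ +-monoʳ-≤ (4 + n₄) (s≤s z≤n) ⟩
    4 + n₄ + (2 + j)      ≤⟨ m+k≤mCk (s≤s (s≤s z≤n)) (≤-trans (≤-reflexive (+-comm (2 + j) 2)) (s≤s (s≤s (s≤s (s≤s (<⇒≤ 1+j≤n₄)))))) ⟩
    (4 + n₄) C (2 + j)    ∎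
    where open ≤-Reasoning
  1+n≤W[U] : suc n ≤ W[U] n (3 + n₄)
  1+n≤W[U] = begin
    6 + n₄                ≡⟨ trans (+-assoc 4 n₄ 2) (cong (λ m → 4 + m) (+-comm n₄ 2)) ⟨
    4 + n₄ + 2            ≤⟨ +-monoʳ-≤ (4 + n₄) (m≤m+n 2 n₄) ⟩
    4 + n₄ + (2 + n₄)     ≤⟨ m+k≤mCk (s≤s (s≤s z≤n)) (≤-reflexive (+-comm (2 + n₄) 2)) ⟩
    (4 + n₄) C (2 + n₄)   ∎
    where open ≤-Reasoning
  head : sumFrom1 (2 + n₄) (term V) ≤ℚ sumFrom1 (2 + n₄) (term W)
  head = sumFrom1-mono-≤ (2 + n₄) λ i 1≤i i≤ → ℕtoℚ-*-mono-≤ (x i)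
           (≤-trans (V< i (≤-trans (s≤s i≤) (≤-trans (n≤1+n _) (n≤1+n _)))) (≤-trans (n≤W[U] i 1≤i i≤) (W≥ i)))
           (0≤x i)
  middle : x (4 + n₄) ≤ℚ x (3 + n₄) +ℚ x n
  middle rewrite m+n∸n≡m 1 n₄ | m+n∸n≡m 2 n₄ | n∸n≡0 n₄ = middle-weight≤outer-weights (2 + n₄) (0≤- p≤1) 0≤p

module _ {n : ℕ} (G : Graph n) where

  IsW⇒CopWinSubsets : ∀ {i w} → IsW G i w → ∃ λ L → Unique L × length L ≡ w × (∀ S → S ∈ L → CopWinSubset G ⊤ i S)
  IsW⇒CopWinSubsets (L , unique , length≡w , exactly) =
    L , unique , length≡w , λ S S∈L → (λ x _ → lookup-replicate x true) , proj₁ (exactly S) S∈L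

  module _ (unicyclic : Unicyclic G) where

    W≤W[U]-withLeaf : HasLeaf G ⊤ → ∀ i {w} → IsW G i w → w ≤ W[U] n i
    W≤W[U]-withLeaf leafy i isW with L , unique , length≡w , family ← IsW⇒CopWinSubsets isW =
      subst (_≤ W[U] n i) length≡w (W≤W[U] G n (∣⊤∣≡n n) (Unicyclic⇒UnicyclicOn⊤ G unicyclic) (inj₁ leafy) i unique family)

    module _ (leafless : ¬ HasLeaf G ⊤) (4≤n : 4 ≤ n) where

      open LeaflessUnicyclic G (Unicyclic⇒UnicyclicOn⊤ G unicyclic) leafless (subst (4 ≤_) (sym (∣⊤∣≡n n)) 4≤n)

      W≤n-cycle : ∀ i {w} → i < n → IsW G i w → w ≤ n
      W≤n-cycle i i<n isW with L , unique , length≡w , family ← IsW⇒CopWinSubsets isW =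
        subst₂ _≤_ length≡w (∣⊤∣≡n n) (CopWinSubsets-length≤k L unique family (subst (i <_) (sym (∣⊤∣≡n n)) i<n))

      W≤0-cycle : ∀ {w} → IsW G n w → w ≤ 0
      W≤0-cycle isW with L , unique , length≡w , family ← IsW⇒CopWinSubsets isW =
        subst (_≤ 0) length≡w (Unique-⊆⇒length≤ {ys = []} unique λ {S} S∈L →
          ⊥-elim (¬CopWinSubset-large (≤-reflexive (∣⊤∣≡n n)) (family S S∈L)))

theorem3p5 : (n : ℕ) → 5 ≤ n → (G : Graph n) → Unicyclic G →
    (WG WU : ℕ → ℕ) → (∀ i → IsW G i (WG i)) → (∀ i → IsW (U n) i (WU i)) →
    (p : ℚ) → 0ℚ ≤ℚ p → p ≤ℚ 1ℚ →
    NCRelPoly n WG p ≤ℚ NCRelPoly n WU p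
theorem3p5 n 5≤n G unicyclic WG WU WG-spec WU-spec p 0≤p p≤1
  with n₄ , refl ← m≤n⇒∃[o]m+o≡n 5≤n | hasLeaf? G ⊤
... | yes leafy = NCRelPoly-mono n 0≤p p≤1 λ i _ _ →
  ≤-trans (W≤W[U]-withLeaf G unicyclic leafy i (WG-spec i)) (W[U]≤W (2 + n₄) i (WU-spec i))
... | no leafless = NCRelPoly-cycle≤ n₄ 0≤p p≤1
  (λ i i<n → W≤n-cycle G unicyclic leafless (≤-trans (n≤1+n 4) 5≤n) i i<n (WG-spec i))
  (W≤0-cycle G unicyclic leafless (≤-trans (n≤1+n 4) 5≤n) (WG-spec n))
  (λ i → W[U]≤W (2 + n₄) i (WU-spec i))
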